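{- Let $\lambda\in\mathbf{k}$ and let $E$ be a set. The operator $P$ on $\overline{\mathcal{F}}_E(\mathrm{ADF})=\bigoplus_{m\ge0}\mathrm{ADF}[\underline{m}]\otimes_{\mathfrak{S}_m}S_E[\underline{m}]$ given by $P\big(\overline{x\otimes(e_i)_{i\in\underline{m}}}\big)=\overline{R_{\underline{m}}(x)\otimes(e_i)_{i\in\underline{m}}}$ is well defined, and with it $\overline{\mathcal{F}}_E(\mathrm{ADF})$ (the span of angularly $E$-decorated forests, with its algebra structure) is a Rota–Baxter algebra of weight $\lambda$.
   Context: $\mathbf{k}$ is a field of characteristic zero. Species: functors from finite sets with bijections to $\mathbf{k}$-vector spaces. For a finite set $X$, $\mathrm{ADF}[X]$ has basis the planar rooted forests with exactly $|X|$ angles (gaps between consecutive leaves left to right, inside a tree or between adjacent trees) decorated bijectively by $X$; $\mathrm{ADF}[\sigma]$ relabels decorations; $\bullet$ is the one-vertex tree; $R_X=B^+$ adds a new root joined to the roots of all trees. $\mathrm{ADF}$ is a twisted algebra with unit $\bullet$ and product $\diamond$ of weight $\lambda$, defined bilinearly by induction on depth: for trees $\bullet\diamond T'=T'$, $T\diamond\bullet=T$, $B^+(A)\diamond B^+(A')=B^+(B^+(A)\diamond A')+B^+(A\diamond B^+(A'))+\lambda B^+(A\diamond A')$; for forests $T_1x_1\cdots x_mT_{m+1}\diamond T'_1y_1\cdots y_nT'_{n+1}=T_1x_1\cdots x_m(T_{m+1}\diamond T'_1)y_1\cdots y_nT'_{n+1}$. $S_E[X]$ is the vector space with basis $E^X$,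 $S_E[\sigma]((e_x)_{x\in X})=(e_{\sigma^{ -1}(y)})_{y\in Y}$, a twisted algebra with product concatenating families (the family on $X\sqcup Y$ restricting to the given ones) and unit the empty family. The Hadamard product $(P\boxtimes Q)[X]=P[X]\otimes Q[X]$ of twisted algebras is a twisted algebra with componentwise product. With $\underline{n}=\{1,\dots,n\}$ and $\sigma_{m,n}:\underline m\sqcup\underline n\to\underline{m+n}$ (identity on $\underline m$, $i\mapsto i+m$ on $\underline n$), $\overline{\mathcal{F}}_E(\mathrm{ADF})=\bigoplus_n\mathrm{ADF}[\underline{n}]\otimes_{\mathfrak{S}_n}S_E[\underline{n}]$ is the space of coinvariants of $(\mathrm{ADF}\boxtimes S_E)[\underline n]$ under $\mathfrak{S}_n$ (so $\overline{\mathrm{ADF}[\alpha](x)\otimes S_E[\alpha](e)}=\overline{x\otimes e}$), with product induced by $z\cdot w=(\mathrm{ADF}\boxtimes S_E)[\sigma_{m,n}](m_{\underline m,\underline n}(z\otimes w))$. A Rota–Baxter algebra of weight $\lambda$ is an algebra $A$ with a linear map $Q$ such that $Q(a)Q(b)=Q(Q(a)b+aQ(b)+\lambda ab)$. -}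

module Defs where

open import Level using (Level; _⊔_) renaming (zero to lzero)
open import Data.Nat using (ℕ; zero; suc) renaming (_+_ to _+ℕ_)
open import Data.Fin using (Fin; zero; suc; _↑ˡ_; _↑ʳ_; join)
open import Data.Sum using (_⊎_; inj₁; inj₂)
open import Data.Product using (Σ; _×_; _,_; proj₁; proj₂)
open import Data.List using (List; []; _∷_; _++_; map; tabulate; allFin)
open import Data.List.Properties using (++-assoc; ++-identityʳ; map-++; map-∘; map-tabulate)
open import Data.List.Relation.Unary.All using (All; []; _∷_)
open import Data.List.Relation.Binary.Permutation.Propositional using (_↭_; ↭-reflexive; ↭-trans)
import Data.List.Relation.Binary.Permutation.Propositional.Properties as PermP
open import Data.Vec using (Vec; lookup) renaming ([] to []ᵥ; tabulate to vtabulate; _++_ to _++ᵥ_)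
open import Data.Fin.Permutation using (Permutation′; _⟨$⟩ʳ_; _⟨$⟩ˡ_)
open import Function using (_∘_; id)
open import Relation.Binary.PropositionalEquality using (_≡_; refl; sym; trans; cong)
open import Relation.Nullary using (¬_)
open import Algebra.Bundles using (CommutativeRing)

record Field (c ℓ : Level) : Set (Level.suc (c ⊔ ℓ)) where
  field
    commutativeRing : CommutativeRing c ℓ
  open CommutativeRing commutativeRing public
  field
    0≉1     : ¬ (0# ≈ 1#)
    inverse : ∀ x → ¬ (x ≈ 0#) → Σ Carrier (λ y → (x * y) ≈ 1#)

  ℕ→K : ℕ → Carrier
  ℕ→K zero    = 0#
  ℕ→K (suc n) = 1# + ℕ→K n

CharZero : ∀ {c ℓ} → Field c ℓ → Set ℓ
CharZero K = ∀ n → ¬ (ℕ→K (suc n) ≈ 0#)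
  where open Field K

-- Planar rooted forests whose angles are decorated by elements of A.  A forest T₁ x₁ T₂ ⋯ xₘ Tₘ₊₁ is a
-- nonempty sequence of trees with a decoration on each angle between
-- adjacent trees.

mutual
  data Tree (A : Set) : Set where
    •    : Tree A
    B⁺   : Forest A → Tree A

  data Forest (A : Set) : Set where
    [_]    : Tree A → Forest A
    _⟨_⟩_ : Tree A → A → Forest A → Forest A

infixr 5 _⟨_⟩_

mutual
  decsT : {A : Set} → Tree A → List A
  decsT •      = []
  decsT (B⁺ F) = decsF F

  decsF : {A : Set} → Forest A → List A
  decsF [ T ]       = decsT T
  decsF (T ⟨ x ⟩ F) = decsT T ++ x ∷ decsF F

mutual
  mapT : {A B : Set} → (A → B) → Tree A → Tree B
  mapT f •      = •
  mapT f (B⁺ F) = B⁺ (mapF f F)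

  mapF : {A B : Set} → (A → B) → Forest A → Forest B
  mapF f [ T ]       = [ mapT f T ]
  mapF f (T ⟨ x ⟩ F) = mapT f T ⟨ f x ⟩ mapF f F

mutual
  decsT-map : {A B : Set} (f : A → B) (T : Tree A) → decsT (mapT f T) ≡ map f (decsT T)
  decsT-map f •      = refl
  decsT-map f (B⁺ F) = decsF-map f F

  decsF-map : {A B : Set} (f : A → B) (F : Forest A) → decsF (mapF f F) ≡ map f (decsF F)
  decsF-map f [ T ]       = decsT-map f T
  decsF-map f (T ⟨ x ⟩ F) =
    trans (cong₂' (decsT-map f T) (cong (f x ∷_) (decsF-map f F)))
          (sym (map-++ f (decsT T) (x ∷ decsF F)))
    where
    cong₂' : ∀ {xs xs' ys ys' : List _} → xs ≡ xs' → ys ≡ ys' → xs ++ ys ≡ xs' ++ ys'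
    cong₂' refl refl = refl

module Over {c ℓ : Level} (K : Field c ℓ) where
  open Field K using (Carrier; _≈_; _+_; _*_; 0#; 1#)

  Lin : Set → Set c
  Lin X = List (Carrier × X)

  mapL : {X Y : Set} → (X → Y) → Lin X → Lin Y
  mapL f = map (λ p → proj₁ p , f (proj₂ p))

  scale : {X : Set} → Carrier → Lin X → Lin X
  scale a = map (λ p → a * proj₁ p , proj₂ p)

  module Diamond (λ′ : Carrier) {A : Set} where
    mutual
      _⋄T_ : Tree A → Tree A → Lin (Tree A)
      • ⋄T T′ = (1# , T′) ∷ []
      (B⁺ F) ⋄T • = (1# , B⁺ F) ∷ []
      (B⁺ F) ⋄T (B⁺ F′) =
           mapL B⁺ (treeForest (B⁺ F) F′)
        ++ mapL B⁺ (forestTree F (B⁺ F′))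
        ++ scale λ′ (mapL B⁺ (forestForest F F′))

      treeForest : Tree A → Forest A → Lin (Forest A)
      treeForest T [ T′ ]       = mapL [_] (T ⋄T T′)
      treeForest T (T′ ⟨ y ⟩ G) = mapL (λ S → S ⟨ y ⟩ G) (T ⋄T T′)

      forestTree : Forest A → Tree A → Lin (Forest A)
      forestTree [ T ]       T′ = mapL [_] (T ⋄T T′)
      forestTree (T ⟨ x ⟩ F) T′ = mapL (T ⟨ x ⟩_) (forestTree F T′)

      forestForest : Forest A → Forest A → Lin (Forest A)
      forestForest [ T ]       G = treeForest T G
      forestForest (T ⟨ x ⟩ F) G = mapL (T ⟨ x ⟩_) (forestForest F G)

    _⋄_ : Forest A → Forest A → Lin (Forest A)
    _⋄_ = forestForest

    private
      AllMapL : {X Y : Set} {P : X → Set} {Q : Y → Set} (f : X → Y) →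
                (∀ {x} → P x → Q (f x)) → (xs : Lin X) →
                All (λ p → P (proj₂ p)) xs → All (λ p → Q (proj₂ p)) (mapL f xs)
      AllMapL f g []       []       = []
      AllMapL f g (x ∷ xs) (p ∷ ps) = g p ∷ AllMapL f g xs ps

      AllScale : {X : Set} {P : X → Set} (a : Carrier) (xs : Lin X) →
                 All (λ p → P (proj₂ p)) xs → All (λ p → P (proj₂ p)) (scale a xs)
      AllScale a []       []       = []
      AllScale a (x ∷ xs) (p ∷ ps) = p ∷ AllScale a xs ps

      All++ : {X : Set} {P : X → Set} (xs ys : Lin X) →
              All (λ p → P (proj₂ p)) xs → All (λ p → P (proj₂ p)) ys →
              All (λ p → P (proj₂ p)) (xs ++ ys)
      All++ []       ys []       qs = qs
      All++ (x ∷ xs) ys (p ∷ ps) qs = p ∷ All++ xs ys ps qs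

    mutual
      ⋄T-decs : (T T′ : Tree A) →
        All (λ p → decsT (proj₂ p) ≡ decsT T ++ decsT T′) (T ⋄T T′)
      ⋄T-decs • T′ = refl ∷ []
      ⋄T-decs (B⁺ F) • = sym (++-identityʳ (decsF F)) ∷ []
      ⋄T-decs (B⁺ F) (B⁺ F′) =
        All++ (mapL B⁺ (treeForest (B⁺ F) F′)) _
          (AllMapL B⁺ id (treeForest (B⁺ F) F′) (tf-decs (B⁺ F) F′))
          (All++ (mapL B⁺ (forestTree F (B⁺ F′))) _
            (AllMapL B⁺ id (forestTree F (B⁺ F′)) (ft-decs F (B⁺ F′)))
            (AllScale λ′ (mapL B⁺ (forestForest F F′))
              (AllMapL B⁺ id (forestForest F F′) (ff-decs F F′))))

      tf-decs : (T : Tree A) (G : Forest A) →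
        All (λ p → decsF (proj₂ p) ≡ decsT T ++ decsF G) (treeForest T G)
      tf-decs T [ T′ ] = AllMapL [_] id (T ⋄T T′) (⋄T-decs T T′)
      tf-decs T (T′ ⟨ y ⟩ G) =
        AllMapL (λ S → S ⟨ y ⟩ G)
          (λ {S} e → trans (cong (_++ y ∷ decsF G) e) (++-assoc (decsT T) (decsT T′) (y ∷ decsF G)))
          (T ⋄T T′) (⋄T-decs T T′)

      ft-decs : (F : Forest A) (T′ : Tree A) →
        All (λ p → decsF (proj₂ p) ≡ decsF F ++ decsT T′) (forestTree F T′)
      ft-decs [ T ] T′ = AllMapL [_] id (T ⋄T T′) (⋄T-decs T T′)
      ft-decs (T ⟨ x ⟩ F) T′ =
        AllMapL (T ⟨ x ⟩_)
          (λ {S} e → trans (cong (λ l → decsT T ++ x ∷ l) e)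
                           (sym (++-assoc (decsT T) (x ∷ decsF F) (decsT T′))))
          (forestTree F T′) (ft-decs F T′)

      ff-decs : (F G : Forest A) →
        All (λ p → decsF (proj₂ p) ≡ decsF F ++ decsF G) (forestForest F G)
      ff-decs [ T ] G = tf-decs T G
      ff-decs (T ⟨ x ⟩ F) G =
        AllMapL (T ⟨ x ⟩_)
          (λ {S} e → trans (cong (λ l → decsT T ++ x ∷ l) e)
                           (sym (++-assoc (decsT T) (x ∷ decsF F) (decsF G))))
          (forestForest F G) (ff-decs F G)

  -- Basis of  ⊕ₙ (ADF ⊠ S_E)[n] :  (n, x, e) with x a planar forest with
  -- exactly n angles decorated bijectively by {1..n} = Fin n (i.e. the
  -- decoration list is a permutation of the list of all elements of
  -- Fin n), and e ∈ Eⁿ.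

  module WithE (E : Set) where

    record Basis : Set where
      constructor mkB
      field
        size   : ℕ
        forest : Forest (Fin size)
        bij    : decsF forest ↭ allFin size
        family : Vec E size
    open Basis public

    -- Equality in the space of coinvariants
    --   F̄_E(ADF) = ⊕ₙ ADF[n] ⊗_{𝔖ₙ} S_E[n] :
    -- formal linear combinations of basis elements modulo the k-vector
    -- space relations and the coinvariant relations  b ~ σ·b.
    infix 4 _≋_
    data _≋_ : Lin Basis → Lin Basis → Set (c ⊔ ℓ) where
      ≋-refl  : ∀ {u} → u ≋ u
      ≋-sym   : ∀ {u v} → u ≋ v → v ≋ u
      ≋-trans : ∀ {u v w} → u ≋ v → v ≋ w → u ≋ w
      ≋-++    : ∀ {u u′ v v′} → u ≋ u′ → v ≋ v′ → u ++ v ≋ u′ ++ v′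
      ≋-comm  : ∀ u v → u ++ v ≋ v ++ u
      ≋-zero  : ∀ b → (0# , b) ∷ [] ≋ []
      ≋-add   : ∀ a a′ b → (a , b) ∷ (a′ , b) ∷ [] ≋ (a + a′ , b) ∷ []
      ≋-coeff : ∀ {a a′} b → a ≈ a′ → (a , b) ∷ [] ≋ (a′ , b) ∷ []
      ≋-orbit : ∀ a n (σ : Permutation′ n) (F : Forest (Fin n)) p q (e : Vec E n) →
                (a , mkB n F p e) ∷ []
                  ≋ (a , mkB n (mapF (σ ⟨$⟩ʳ_) F) q (vtabulate (λ y → lookup e (σ ⟨$⟩ˡ y)))) ∷ []
      ≋-irr   : ∀ a n (F : Forest (Fin n)) p q (e : Vec E n) →
                (a , mkB n F p e) ∷ [] ≋ (a , mkB n F q e) ∷ []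

    -- The operator P, induced by R_n = B⁺ :  x ⊗ e ↦ B⁺(x) ⊗ e
    P₀ : Basis → Basis
    P₀ (mkB n F p e) = mkB n [ B⁺ F ] p e

    P : Lin Basis → Lin Basis
    P = mapL P₀

    -- The product:  z · w = (ADF ⊠ S_E)[σ_{m,n}] (m_{m,n}(z ⊗ w)),
    -- σ_{m,n} = join m n : Fin m ⊎ Fin n → Fin (m +ℕ n)
    private
      allFin-split : ∀ m n {B : Set} (f : Fin (m +ℕ n) → B) →
        tabulate (λ i → f (i ↑ˡ n)) ++ tabulate (λ j → f (m ↑ʳ j)) ≡ tabulate f
      allFin-split zero    n f = refl
      allFin-split (suc m) n f = cong (f zero ∷_) (allFin-split m n (λ i → f (suc i)))

      attach : {X : Set} {P : X → Set} (xs : Lin X) →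
               All (λ p → P (proj₂ p)) xs → List (Carrier × Σ X P)
      attach []             []       = []
      attach ((a , x) ∷ xs) (p ∷ ps) = (a , (x , p)) ∷ attach xs ps

    module Product (λ′ : Carrier) where
      open module D {A : Set} = Diamond λ′ {A}

      private
        bij-join : ∀ m n (F : Forest (Fin m)) (G : Forest (Fin n)) →
          decsF F ↭ allFin m → decsF G ↭ allFin n →
          (H : Forest (Fin m ⊎ Fin n)) →
          decsF H ≡ decsF (mapF inj₁ F) ++ decsF (mapF inj₂ G) →
          decsF (mapF (join m n) H) ↭ allFin (m +ℕ n)
        bij-join m n F G p q H e =
          ↭-trans (↭-reflexive step)
            (↭-trans (PermP.++⁺ (PermP.map⁺ (_↑ˡ n) p) (PermP.map⁺ (m ↑ʳ_) q))
              (↭-reflexive (trans (cong₂' (map-tabulate id (_↑ˡ n)) (map-tabulate id (m ↑ʳ_)))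
                                  (allFin-split m n id))))
          where
          cong₂' : ∀ {B : Set} {xs xs' ys ys' : List B} → xs ≡ xs' → ys ≡ ys' → xs ++ ys ≡ xs' ++ ys'
          cong₂' refl refl = refl
          step : decsF (mapF (join m n) H) ≡ map (_↑ˡ n) (decsF F) ++ map (m ↑ʳ_) (decsF G)
          step = trans (decsF-map (join m n) H)
                 (trans (cong (map (join m n)) e)
                 (trans (cong (map (join m n)) (cong₂' (decsF-map inj₁ F) (decsF-map inj₂ G)))
                 (trans (map-++ (join m n) (map inj₁ (decsF F)) (map inj₂ (decsF G)))
                        (cong₂' (sym (map-∘ (decsF F))) (sym (map-∘ (decsF G)))))))

      _·₀_ : Basis → Basis → Lin Basis
      mkB m F p e ·₀ mkB n G q e′ =
        map (λ t → proj₁ t ,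
                   mkB (m +ℕ n) (mapF (join m n) (proj₁ (proj₂ t)))
                       (bij-join m n F G p q (proj₁ (proj₂ t)) (proj₂ (proj₂ t)))
                       (e ++ᵥ e′))
            (attach (mapF inj₁ F ⋄ mapF inj₂ G) (ff-decs (mapF inj₁ F) (mapF inj₂ G)))

      _·_ : Lin Basis → Lin Basis → Lin Basis
      []             · v = []
      ((a , b) ∷ u)  · v = go v ++ (u · v)
        where
        go : Lin Basis → Lin Basis
        go []              = []
        go ((a′ , b′) ∷ v′) = scale (a * a′) (b ·₀ b′) ++ go v′

      infixl 7 _·_

    unit : Lin Basis
    unit = (1# , mkB 0 [ • ] ↭-refl′ []ᵥ) ∷ []
      where
      ↭-refl′ : decsF {Fin 0} [ • ] ↭ allFin 0
      ↭-refl′ = ↭-reflexive refl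

    -- F̄_E(ADF), with its algebra structure (product induced by ⋄ of
    -- weight λ, unit •) and the operator P, is a Rota–Baxter algebra
    -- of weight λ.  (Addition is concatenation _++_, scalar
    -- multiplication is scale, equality is _≋_.)
    record IsRotaBaxterAlgebra (λ′ : Carrier) : Set (c ⊔ ℓ) where
      open Product λ′
      field
        ·-cong      : ∀ {u u′ v v′} → u ≋ u′ → v ≋ v′ → u · v ≋ u′ · v′
        ·-assoc     : ∀ u v w → (u · v) · w ≋ u · (v · w)
        ·-identityˡ : ∀ u → unit · u ≋ u
        ·-identityʳ : ∀ u → u · unit ≋ u
        ·-distribˡ  : ∀ u v w → u · (v ++ w) ≋ u · v ++ u · w
        ·-distribʳ  : ∀ u v w → (v ++ w) · u ≋ v · u ++ w · u
        ·-scaleˡ    : ∀ a u v → scale a u · v ≋ scale a (u · v)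
        ·-scaleʳ    : ∀ a u v → u · scale a v ≋ scale a (u · v)
        P-cong      : ∀ {u v} → u ≋ v → P u ≋ P v
        P-+         : ∀ u v → P (u ++ v) ≋ P u ++ P v
        P-scale     : ∀ a u → P (scale a u) ≋ scale a (P u)
        P-RotaBaxter : ∀ u v →
          P u · P v ≋ P (P u · v ++ u · P v ++ scale λ′ (u · v))

{-# OPTIONS --safe #-}
-- Both the product and P act basis element by basis element, so everything reduces to decorated forests.
-- There B⁺(F) ⋄ B⁺(G) = B⁺(B⁺(F) ⋄ G) + B⁺(F ⋄ B⁺(G)) + λ B⁺(F ⋄ G) is literally the Rota–Baxter identity
-- for F ↦ B⁺(F). Associativity of ⋄ is a simultaneous induction on depth over the eight ways of combining
-- trees and forests; for three grafted trees both bracketings expand, by induction, into the same seven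
-- terms with the same powers of λ.
-- The product of two basis elements is the ⋄-product of their forests with decorations moved apart by
-- σ_{m,n}. Since ⋄ commutes with relabelling, this respects the coinvariant relations, and it inherits
-- associativity because the two bracketings differ by the relabelling Fin ((m+n)+k) ≅ Fin (m+(n+k)),
-- which is itself a coinvariant relation.
module Submission where

open import Level using (Level; _⊔_)
open import Algebra.Bundles using (CommutativeMonoid)
import Algebra.Properties.CommutativeSemigroup as CommutativeSemigroupProperties
open import Data.Empty using (⊥-elim)
open import Data.Fin as Fin using (Fin; _↑ˡ_; _↑ʳ_; join; splitAt)
import Data.Fin.Properties as Finₚ
open Finₚ using (+↔⊎)
open import Data.Fin.Permutation using (Permutation; Permutation′; _⟨$⟩ʳ_; _⟨$⟩ˡ_; inverseˡ; ↔⇒≡; cast-id)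
  renaming (id to idₚ)
open import Data.List as List using (List; []; _∷_; _++_; map; allFin)
open import Data.List.Properties as Listₚ using (++-assoc; ++-identityʳ; map-++)
open import Data.List.Relation.Unary.All as All using (All; []; _∷_)
import Data.List.Relation.Unary.All.Properties as Allₚ
open import Data.List.Relation.Binary.Permutation.Propositional
  using (_↭_; ↭-reflexive; ↭-trans; module PermutationReasoning)
import Data.List.Relation.Binary.Permutation.Propositional.Properties as ↭ₚ
open import Data.Nat using (ℕ; zero; suc) renaming (_+_ to _+ℕ_)
import Data.Nat.Properties as ℕₚ
open import Data.Product using (_×_; _,_; proj₂)
open import Data.Sum as ⊎ using (_⊎_; inj₁; inj₂; [_,_]′)
open import Data.Sum.Function.Propositional using (_⊎-↔_)
open import Data.Vec as Vec using (Vec; lookup; tabulate) renaming (_++_ to _++ᵥ_; [] to []ᵥ)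
import Data.Vec.Properties as Vecₚ
open import Function using (_∘_; id)
open import Function.Construct.Composition using (_↔-∘_)
open import Function.Construct.Symmetry using (↔-sym)
open import Relation.Binary.Bundles using (Setoid)
open import Relation.Binary.PropositionalEquality using (_≡_; refl; sym; trans; cong; cong₂; module ≡-Reasoning)
import Relation.Binary.Reasoning.Setoid as SetoidReasoning
open import Relation.Nullary using (Dec; yes; no)

open import Defs

mutual
  mapT-∘ : {X Y Z : Set} (f : Y → Z) (g : X → Y) (T : Tree X) → mapT f (mapT g T) ≡ mapT (f ∘ g) T
  mapT-∘ f g •      = refl
  mapT-∘ f g (B⁺ F) = cong B⁺ (mapF-∘ f g F)

  mapF-∘ : {X Y Z : Set} (f : Y → Z) (g : X → Y) (F : Forest X) → mapF f (mapF g F) ≡ mapF (f ∘ g) F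
  mapF-∘ f g [ T ]       = cong [_] (mapT-∘ f g T)
  mapF-∘ f g (T ⟨ x ⟩ F) = cong₂ (_⟨ f (g x) ⟩_) (mapT-∘ f g T) (mapF-∘ f g F)

mutual
  mapT-cong : {X Y : Set} {f g : X → Y} → (∀ x → f x ≡ g x) → (T : Tree X) → mapT f T ≡ mapT g T
  mapT-cong f≗g •      = refl
  mapT-cong f≗g (B⁺ F) = cong B⁺ (mapF-cong f≗g F)

  mapF-cong : {X Y : Set} {f g : X → Y} → (∀ x → f x ≡ g x) → (F : Forest X) → mapF f F ≡ mapF g F
  mapF-cong f≗g [ T ]       = cong [_] (mapT-cong f≗g T)
  mapF-cong f≗g (T ⟨ x ⟩ F) rewrite mapT-cong f≗g T | f≗g x | mapF-cong f≗g F = refl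

mutual
  mapT-id : {X : Set} (T : Tree X) → mapT id T ≡ T
  mapT-id •      = refl
  mapT-id (B⁺ F) = cong B⁺ (mapF-id F)

  mapF-id : {X : Set} (F : Forest X) → mapF id F ≡ F
  mapF-id [ T ]       = cong [_] (mapT-id T)
  mapF-id (T ⟨ x ⟩ F) = cong₂ (_⟨ x ⟩_) (mapT-id T) (mapF-id F)

graft : {A : Set} → Forest A → Forest A
graft F = [ B⁺ F ]

module _ {m m′ n n′ : ℕ} where
  _⊕_ : Permutation m m′ → Permutation n n′ → Permutation (m +ℕ n) (m′ +ℕ n′)
  σ ⊕ ρ = ↔-sym +↔⊎ ↔-∘ ((σ ⊎-↔ ρ) ↔-∘ +↔⊎)

  ⊕-join : (σ : Permutation m m′) (ρ : Permutation n n′) (x : Fin m ⊎ Fin n) →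
           (σ ⊕ ρ) ⟨$⟩ʳ join m n x ≡ join m′ n′ (⊎.map (σ ⟨$⟩ʳ_) (ρ ⟨$⟩ʳ_) x)
  ⊕-join σ ρ x = cong (join m′ n′ ∘ ⊎.map (σ ⟨$⟩ʳ_) (ρ ⟨$⟩ʳ_)) (Finₚ.splitAt-join m n x)

⟨$⟩ʳ-injective : ∀ {N N′} (π : Permutation N N′) {i j : Fin N} → π ⟨$⟩ʳ i ≡ π ⟨$⟩ʳ j → i ≡ j
⟨$⟩ʳ-injective π eq = trans (sym (inverseˡ π)) (trans (cong (π ⟨$⟩ˡ_) eq) (inverseˡ π))

permute : {A : Set} {N N′ : ℕ} → Permutation N N′ → Vec A N → Vec A N′
permute π e = tabulate (λ y → lookup e (π ⟨$⟩ˡ y))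

module _ {A : Set} where
  permute-⊕ : ∀ {m n} (σ : Permutation′ m) (ρ : Permutation′ n) (e : Vec A m) (e′ : Vec A n) →
              permute (σ ⊕ ρ) (e ++ᵥ e′) ≡ permute σ e ++ᵥ permute ρ e′
  permute-⊕ {m} {n} σ ρ e e′ = trans (Vecₚ.tabulate-cong pointwise) (Vecₚ.tabulate∘lookup _)
    where
    split : ∀ z → [ lookup e , lookup e′ ]′ (⊎.map (σ ⟨$⟩ˡ_) (ρ ⟨$⟩ˡ_) z)
                  ≡ [ lookup (permute σ e) , lookup (permute ρ e′) ]′ z
    split (inj₁ x) = sym (Vecₚ.lookup∘tabulate _ x)
    split (inj₂ y) = sym (Vecₚ.lookup∘tabulate _ y)
    pointwise : ∀ y → lookup (e ++ᵥ e′) ((σ ⊕ ρ) ⟨$⟩ˡ y) ≡ lookup (permute σ e ++ᵥ permute ρ e′) y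
    pointwise y = begin
      lookup (e ++ᵥ e′) (join m n z)                                ≡⟨ Vecₚ.lookup-splitAt m e e′ _ ⟩
      [ lookup e , lookup e′ ]′ (splitAt m (join m n z))            ≡⟨ cong [ lookup e , lookup e′ ]′ (Finₚ.splitAt-join m n z) ⟩
      [ lookup e , lookup e′ ]′ z                                   ≡⟨ split (splitAt m y) ⟩
      [ lookup (permute σ e) , lookup (permute ρ e′) ]′ (splitAt m y) ≡⟨ Vecₚ.lookup-splitAt m (permute σ e) (permute ρ e′) y ⟨
      lookup (permute σ e ++ᵥ permute ρ e′) y                       ∎
      where
      open ≡-Reasoning
      z : Fin m ⊎ Fin n
      z = ⊎.map (σ ⟨$⟩ˡ_) (ρ ⟨$⟩ˡ_) (splitAt m y)

  permute-id : ∀ {N} (e : Vec A N) → permute idₚ e ≡ e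
  permute-id = Vecₚ.tabulate∘lookup

  permute-cast-id : ∀ {N N′} (eq : N ≡ N′) (e : Vec A N) → permute (cast-id eq) e ≡ Vec.cast eq e
  permute-cast-id eq e =
    trans (Vecₚ.tabulate-cong (λ y → sym (Vecₚ.lookup-cast₁ eq e y))) (Vecₚ.tabulate∘lookup (Vec.cast eq e))

tabulate-+ : ∀ m n {B : Set} (f : Fin (m +ℕ n) → B) →
             List.tabulate (f ∘ (_↑ˡ n)) ++ List.tabulate (f ∘ (m ↑ʳ_)) ≡ List.tabulate f
tabulate-+ zero    n f = refl
tabulate-+ (suc m) n f = cong (f Fin.zero ∷_) (tabulate-+ m n (f ∘ Fin.suc))

map-++-map : {A A′ B C : Set} (f : B → C) (g : A → B) (h : A′ → B) (xs : List A) (ys : List A′) →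
             map f (map g xs ++ map h ys) ≡ map (f ∘ g) xs ++ map (f ∘ h) ys
map-++-map f g h xs ys =
  trans (map-++ f (map g xs) (map h ys)) (cong₂ _++_ (sym (Listₚ.map-∘ xs)) (sym (Listₚ.map-∘ ys)))

module _ {m n : ℕ} where
  joinWord : List (Fin m) → List (Fin n) → List (Fin (m +ℕ n))
  joinWord xs ys = map (_↑ˡ n) xs ++ map (m ↑ʳ_) ys

  joinWord-↭ : {xs : List (Fin m)} {ys : List (Fin n)} →
               xs ↭ allFin m → ys ↭ allFin n → joinWord xs ys ↭ allFin (m +ℕ n)
  joinWord-↭ {xs} {ys} p q = begin
    map (_↑ˡ n) xs ++ map (m ↑ʳ_) ys
      ↭⟨ ↭ₚ.++⁺ (↭ₚ.map⁺ (_↑ˡ n) p) (↭ₚ.map⁺ (m ↑ʳ_) q) ⟩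
    map (_↑ˡ n) (allFin m) ++ map (m ↑ʳ_) (allFin n)
      ≡⟨ cong₂ _++_ (Listₚ.map-tabulate id (_↑ˡ n)) (Listₚ.map-tabulate id (m ↑ʳ_)) ⟩
    List.tabulate (_↑ˡ n) ++ List.tabulate (m ↑ʳ_)
      ≡⟨ tabulate-+ m n id ⟩
    allFin (m +ℕ n) ∎
    where open PermutationReasoning

joinWord-⊕ : ∀ {m m′ n n′} (σ : Permutation m m′) (ρ : Permutation n n′) (xs : List (Fin m)) (ys : List (Fin n)) →
             map ((σ ⊕ ρ) ⟨$⟩ʳ_) (joinWord xs ys) ≡ joinWord (map (σ ⟨$⟩ʳ_) xs) (map (ρ ⟨$⟩ʳ_) ys)
joinWord-⊕ {m} {m′} {n} {n′} σ ρ xs ys = begin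
  map ((σ ⊕ ρ) ⟨$⟩ʳ_) (map (_↑ˡ n) xs ++ map (m ↑ʳ_) ys)
    ≡⟨ map-++-map _ (_↑ˡ n) (m ↑ʳ_) xs ys ⟩
  map (((σ ⊕ ρ) ⟨$⟩ʳ_) ∘ (_↑ˡ n)) xs ++ map (((σ ⊕ ρ) ⟨$⟩ʳ_) ∘ (m ↑ʳ_)) ys
    ≡⟨ cong₂ _++_ (Listₚ.map-cong (⊕-join σ ρ ∘ inj₁) xs) (Listₚ.map-cong (⊕-join σ ρ ∘ inj₂) ys) ⟩
  map ((_↑ˡ n′) ∘ (σ ⟨$⟩ʳ_)) xs ++ map ((m′ ↑ʳ_) ∘ (ρ ⟨$⟩ʳ_)) ys
    ≡⟨ cong₂ _++_ (Listₚ.map-∘ xs) (Listₚ.map-∘ ys) ⟩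
  map (_↑ˡ n′) (map (σ ⟨$⟩ʳ_) xs) ++ map (m′ ↑ʳ_) (map (ρ ⟨$⟩ʳ_) ys) ∎
  where open ≡-Reasoning

module _ (m n k : ℕ) where
  assocˡ-label : (Fin m ⊎ Fin n) ⊎ Fin k → Fin ((m +ℕ n) +ℕ k)
  assocˡ-label = join (m +ℕ n) k ∘ ⊎.map (join m n) id

  assocʳ-label : (Fin m ⊎ Fin n) ⊎ Fin k → Fin (m +ℕ (n +ℕ k))
  assocʳ-label = join m (n +ℕ k) ∘ [ [ inj₁ , inj₂ ∘ join n k ∘ inj₁ ]′ , inj₂ ∘ join n k ∘ inj₂ ]′

  assocʳ-label≡cast : ∀ x → assocʳ-label x ≡ Fin.cast (ℕₚ.+-assoc m n k) (assocˡ-label x)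
  assocʳ-label≡cast x = Finₚ.toℕ-injective (trans (toℕ-assocʳ x) (sym (Finₚ.toℕ-cast _ (assocˡ-label x))))
    where
    open ≡-Reasoning
    toℕ-assocʳ : ∀ x → Fin.toℕ (assocʳ-label x) ≡ Fin.toℕ (assocˡ-label x)
    toℕ-assocʳ (inj₁ (inj₁ i)) = begin
      Fin.toℕ (i ↑ˡ (n +ℕ k))    ≡⟨ Finₚ.toℕ-↑ˡ i (n +ℕ k) ⟩
      Fin.toℕ i                  ≡⟨ Finₚ.toℕ-↑ˡ i n ⟨
      Fin.toℕ (i ↑ˡ n)           ≡⟨ Finₚ.toℕ-↑ˡ (i ↑ˡ n) k ⟨
      Fin.toℕ ((i ↑ˡ n) ↑ˡ k)    ∎
    toℕ-assocʳ (inj₁ (inj₂ j)) = begin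
      Fin.toℕ (m ↑ʳ (j ↑ˡ k))    ≡⟨ Finₚ.toℕ-↑ʳ m (j ↑ˡ k) ⟩
      m +ℕ Fin.toℕ (j ↑ˡ k)      ≡⟨ cong (m +ℕ_) (Finₚ.toℕ-↑ˡ j k) ⟩
      m +ℕ Fin.toℕ j             ≡⟨ Finₚ.toℕ-↑ʳ m j ⟨
      Fin.toℕ (m ↑ʳ j)           ≡⟨ Finₚ.toℕ-↑ˡ (m ↑ʳ j) k ⟨
      Fin.toℕ ((m ↑ʳ j) ↑ˡ k)    ∎
    toℕ-assocʳ (inj₂ l) = begin
      Fin.toℕ (m ↑ʳ (n ↑ʳ l))    ≡⟨ Finₚ.toℕ-↑ʳ m (n ↑ʳ l) ⟩
      m +ℕ Fin.toℕ (n ↑ʳ l)      ≡⟨ cong (m +ℕ_) (Finₚ.toℕ-↑ʳ n l) ⟩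
      m +ℕ (n +ℕ Fin.toℕ l)      ≡⟨ ℕₚ.+-assoc m n (Fin.toℕ l) ⟨
      (m +ℕ n) +ℕ Fin.toℕ l      ≡⟨ Finₚ.toℕ-↑ʳ (m +ℕ n) l ⟨
      Fin.toℕ ((m +ℕ n) ↑ʳ l)    ∎

  joinWord-assoc : (xs : List (Fin m)) (ys : List (Fin n)) (zs : List (Fin k)) →
                   joinWord xs (joinWord ys zs) ≡ map (Fin.cast (ℕₚ.+-assoc m n k)) (joinWord (joinWord xs ys) zs)
  joinWord-assoc xs ys zs = begin
    map (_↑ˡ (n +ℕ k)) xs ++ map (m ↑ʳ_) (map (_↑ˡ k) ys ++ map (n ↑ʳ_) zs)
      ≡⟨ cong (map (_↑ˡ (n +ℕ k)) xs ++_) (map-++-map (m ↑ʳ_) (_↑ˡ k) (n ↑ʳ_) ys zs) ⟩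
    map (assocʳ-label ∘ inj₁ ∘ inj₁) xs ++ map (assocʳ-label ∘ inj₁ ∘ inj₂) ys ++ map (assocʳ-label ∘ inj₂) zs
      ≡⟨ cong₂ _++_ (Listₚ.map-cong (assocʳ-label≡cast ∘ inj₁ ∘ inj₁) xs)
                    (cong₂ _++_ (Listₚ.map-cong (assocʳ-label≡cast ∘ inj₁ ∘ inj₂) ys)
                                (Listₚ.map-cong (assocʳ-label≡cast ∘ inj₂) zs)) ⟩
    map (cast ∘ assocˡ-label ∘ inj₁ ∘ inj₁) xs ++ map (cast ∘ assocˡ-label ∘ inj₁ ∘ inj₂) ys
      ++ map (cast ∘ assocˡ-label ∘ inj₂) zs
      ≡⟨ ++-assoc (map (cast ∘ assocˡ-label ∘ inj₁ ∘ inj₁) xs) _ _ ⟨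
    (map (cast ∘ assocˡ-label ∘ inj₁ ∘ inj₁) xs ++ map (cast ∘ assocˡ-label ∘ inj₁ ∘ inj₂) ys)
      ++ map (cast ∘ assocˡ-label ∘ inj₂) zs
      ≡⟨ cong (_++ map (cast ∘ assocˡ-label ∘ inj₂) zs) (map-++-map (cast ∘ (_↑ˡ k)) (_↑ˡ n) (m ↑ʳ_) xs ys) ⟨
    map (cast ∘ (_↑ˡ k)) (map (_↑ˡ n) xs ++ map (m ↑ʳ_) ys) ++ map (cast ∘ ((m +ℕ n) ↑ʳ_)) zs
      ≡⟨ map-++-map cast (_↑ˡ k) ((m +ℕ n) ↑ʳ_) (map (_↑ˡ n) xs ++ map (m ↑ʳ_) ys) zs ⟨
    map cast (map (_↑ˡ k) (map (_↑ˡ n) xs ++ map (m ↑ʳ_) ys) ++ map ((m +ℕ n) ↑ʳ_) zs) ∎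
    where
    open ≡-Reasoning
    cast : Fin ((m +ℕ n) +ℕ k) → Fin (m +ℕ (n +ℕ k))
    cast = Fin.cast (ℕₚ.+-assoc m n k)

module FormalSums {c ℓ : Level} (K : Field c ℓ) where
  open Field K using (Carrier; _≈_; _+_; _*_; 0#; 1#; *-assoc; *-comm; *-identityˡ; *-identityʳ;
    zeroˡ; zeroʳ; distribˡ; distribʳ; *-cong)
    renaming (refl to ≈-refl; sym to ≈-sym)
  open Over K using (Lin; mapL; scale)

  infix 4 _∼_
  data _∼_ {X : Set} : Lin X → Lin X → Set (c ⊔ ℓ) where
    ∼-refl  : ∀ {u} → u ∼ u
    ∼-sym   : ∀ {u v} → u ∼ v → v ∼ u
    ∼-trans : ∀ {u v w} → u ∼ v → v ∼ w → u ∼ w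
    ∼-++    : ∀ {u u′ v v′} → u ∼ u′ → v ∼ v′ → u ++ v ∼ u′ ++ v′
    ∼-comm  : ∀ u v → u ++ v ∼ v ++ u
    ∼-zero  : ∀ x → (0# , x) ∷ [] ∼ []
    ∼-add   : ∀ a a′ x → (a , x) ∷ (a′ , x) ∷ [] ∼ (a + a′ , x) ∷ []
    ∼-coeff : ∀ {a a′} x → a ≈ a′ → (a , x) ∷ [] ∼ (a′ , x) ∷ []

  module _ {X : Set} where
    ≡⇒∼ : {u v : Lin X} → u ≡ v → u ∼ v
    ≡⇒∼ refl = ∼-refl

    ∼-++ˡ : (u : Lin X) {v w : Lin X} → v ∼ w → u ++ v ∼ u ++ w
    ∼-++ˡ u = ∼-++ ∼-refl

    ∼-++ʳ : {u v : Lin X} (w : Lin X) → u ∼ v → u ++ w ∼ v ++ w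
    ∼-++ʳ w p = ∼-++ p ∼-refl

    ∼-commutativeMonoid : CommutativeMonoid c (c ⊔ ℓ)
    ∼-commutativeMonoid = record
      { Carrier             = Lin X
      ; _≈_                 = _∼_
      ; _∙_                 = _++_
      ; ε                   = []
      ; isCommutativeMonoid = record
        { isMonoid = record
          { isSemigroup = record
            { isMagma = record
              { isEquivalence = record { refl = ∼-refl ; sym = ∼-sym ; trans = ∼-trans }
              ; ∙-cong        = ∼-++ }
            ; assoc = λ u v w → ≡⇒∼ (++-assoc u v w) }
          ; identity = (λ _ → ∼-refl) , (λ u → ≡⇒∼ (++-identityʳ u)) }
        ; comm = ∼-comm } }

    open CommutativeMonoid ∼-commutativeMonoid public
      using () renaming (setoid to ∼-setoid; assoc to ∼-assoc; identityʳ to ∼-identityʳ)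
    open CommutativeSemigroupProperties (CommutativeMonoid.commutativeSemigroup ∼-commutativeMonoid) public
      using () renaming (interchange to ∼-interchange; x∙yz≈y∙xz to ∼-leftComm)

  module ∼-Reasoning {X : Set} = SetoidReasoning (∼-setoid {X})

  module _ {X : Set} where
    scale-++ : (a : Carrier) (u v : Lin X) → scale a (u ++ v) ≡ scale a u ++ scale a v
    scale-++ a = map-++ _

    scale-cong : (a : Carrier) {u v : Lin X} → u ∼ v → scale a u ∼ scale a v
    scale-cong a ∼-refl               = ∼-refl
    scale-cong a (∼-sym p)            = ∼-sym (scale-cong a p)
    scale-cong a (∼-trans p q)        = ∼-trans (scale-cong a p) (scale-cong a q)
    scale-cong a (∼-++ {u} {u′} {v} {v′} p q) = begin
      scale a (u ++ v)           ≡⟨ scale-++ a u v ⟩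
      scale a u ++ scale a v     ≈⟨ ∼-++ (scale-cong a p) (scale-cong a q) ⟩
      scale a u′ ++ scale a v′   ≡⟨ scale-++ a u′ v′ ⟨
      scale a (u′ ++ v′)         ∎
      where open ∼-Reasoning
    scale-cong a (∼-comm u v)         = begin
      scale a (u ++ v)        ≡⟨ scale-++ a u v ⟩
      scale a u ++ scale a v  ≈⟨ ∼-comm (scale a u) (scale a v) ⟩
      scale a v ++ scale a u  ≡⟨ scale-++ a v u ⟨
      scale a (v ++ u)        ∎
      where open ∼-Reasoning
    scale-cong a (∼-zero x)           = ∼-trans (∼-coeff x (zeroʳ a)) (∼-zero x)
    scale-cong a (∼-add b b′ x)       = ∼-trans (∼-add _ _ x) (∼-coeff x (≈-sym (distribˡ a b b′)))
    scale-cong a (∼-coeff x p)        = ∼-coeff x (*-cong ≈-refl p)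

    scale-scale : (a b : Carrier) (u : Lin X) → scale a (scale b u) ∼ scale (a * b) u
    scale-scale a b []            = ∼-refl
    scale-scale a b ((d , x) ∷ u) = ∼-++ (∼-coeff x (≈-sym (*-assoc a b d))) (scale-scale a b u)

    scale-1# : (u : Lin X) → scale 1# u ∼ u
    scale-1# []            = ∼-refl
    scale-1# ((d , x) ∷ u) = ∼-++ (∼-coeff x (*-identityˡ d)) (scale-1# u)

    scale-0# : (u : Lin X) → scale 0# u ∼ []
    scale-0# []            = ∼-refl
    scale-0# ((d , x) ∷ u) = ∼-++ (∼-trans (∼-coeff x (zeroˡ d)) (∼-zero x)) (scale-0# u)

    scale-≈ : {a b : Carrier} (u : Lin X) → a ≈ b → scale a u ∼ scale b u
    scale-≈ []            a≈b = ∼-refl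
    scale-≈ ((d , x) ∷ u) a≈b = ∼-++ (∼-coeff x (*-cong a≈b ≈-refl)) (scale-≈ u a≈b)

    scale-+ : (a b : Carrier) (u : Lin X) → scale a u ++ scale b u ∼ scale (a + b) u
    scale-+ a b []            = ∼-refl
    scale-+ a b ((d , x) ∷ u) = begin
      ((a * d , x) ∷ scale a u) ++ ((b * d , x) ∷ scale b u)
        ≈⟨ ∼-++ˡ ((a * d , x) ∷ []) (∼-leftComm (scale a u) ((b * d , x) ∷ []) (scale b u)) ⟩
      (a * d , x) ∷ (b * d , x) ∷ (scale a u ++ scale b u)
        ≈⟨ ∼-++ (∼-add _ _ x) (scale-+ a b u) ⟩
      (a * d + b * d , x) ∷ scale (a + b) u
        ≈⟨ ∼-++ʳ (scale (a + b) u) (∼-coeff x (≈-sym (distribʳ d a b))) ⟩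
      ((a + b) * d , x) ∷ scale (a + b) u ∎
      where open ∼-Reasoning

    scale-comm : (a b : Carrier) (u : Lin X) → scale a (scale b u) ∼ scale b (scale a u)
    scale-comm a b u =
      ∼-trans (scale-scale a b u) (∼-trans (scale-≈ u (*-comm a b)) (∼-sym (scale-scale b a u)))

  module _ {X Y : Set} where
    mapL-++ : (f : X → Y) (u v : Lin X) → mapL f (u ++ v) ≡ mapL f u ++ mapL f v
    mapL-++ f = map-++ _

    mapL-cong : (f : X → Y) {u v : Lin X} → u ∼ v → mapL f u ∼ mapL f v
    mapL-cong f ∼-refl        = ∼-refl
    mapL-cong f (∼-sym p)     = ∼-sym (mapL-cong f p)
    mapL-cong f (∼-trans p q) = ∼-trans (mapL-cong f p) (mapL-cong f q)
    mapL-cong f (∼-++ {u} {u′} {v} {v′} p q) = begin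
      mapL f (u ++ v)           ≡⟨ mapL-++ f u v ⟩
      mapL f u ++ mapL f v      ≈⟨ ∼-++ (mapL-cong f p) (mapL-cong f q) ⟩
      mapL f u′ ++ mapL f v′    ≡⟨ mapL-++ f u′ v′ ⟨
      mapL f (u′ ++ v′)         ∎
      where open ∼-Reasoning
    mapL-cong f (∼-comm u v)  = begin
      mapL f (u ++ v)       ≡⟨ mapL-++ f u v ⟩
      mapL f u ++ mapL f v  ≈⟨ ∼-comm (mapL f u) (mapL f v) ⟩
      mapL f v ++ mapL f u  ≡⟨ mapL-++ f v u ⟨
      mapL f (v ++ u)       ∎
      where open ∼-Reasoning
    mapL-cong f (∼-zero x)     = ∼-zero (f x)
    mapL-cong f (∼-add a a′ x) = ∼-add a a′ (f x)
    mapL-cong f (∼-coeff x p)  = ∼-coeff (f x) p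

    mapL-scale : (f : X → Y) (a : Carrier) (u : Lin X) → mapL f (scale a u) ≡ scale a (mapL f u)
    mapL-scale f a []      = refl
    mapL-scale f a (x ∷ u) = cong (_ ∷_) (mapL-scale f a u)

    mapL-ext : {f g : X → Y} → (∀ x → f x ≡ g x) → (u : Lin X) → mapL f u ≡ mapL g u
    mapL-ext f≗g []            = refl
    mapL-ext f≗g ((a , x) ∷ u) = cong₂ (λ y r → (a , y) ∷ r) (f≗g x) (mapL-ext f≗g u)

  mapL-∘ : {X Y Z : Set} (f : Y → Z) (g : X → Y) (u : Lin X) → mapL f (mapL g u) ≡ mapL (f ∘ g) u
  mapL-∘ f g []      = refl
  mapL-∘ f g (x ∷ u) = cong (_ ∷_) (mapL-∘ f g u)

  mapL-id : {X : Set} (u : Lin X) → mapL id u ≡ u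
  mapL-id []      = refl
  mapL-id (x ∷ u) = cong (x ∷_) (mapL-id u)

  bind : {X Y : Set} → (Carrier → X → Lin Y) → Lin X → Lin Y
  bind φ []            = []
  bind φ ((a , x) ∷ u) = φ a x ++ bind φ u

  bind-++ : {X Y : Set} (φ : Carrier → X → Lin Y) (u v : Lin X) → bind φ (u ++ v) ≡ bind φ u ++ bind φ v
  bind-++ φ []            v = refl
  bind-++ φ ((a , x) ∷ u) v = trans (cong (φ a x ++_) (bind-++ φ u v)) (sym (++-assoc (φ a x) (bind φ u) (bind φ v)))

  module _ {X Y : Set} (φ : Carrier → X → Lin Y)
           (φ-0#    : ∀ x → φ 0# x ∼ [])
           (φ-+     : ∀ a a′ x → φ a x ++ φ a′ x ∼ φ (a + a′) x)
           (φ-coeff : ∀ {a a′} x → a ≈ a′ → φ a x ∼ φ a′ x) where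
    bind-cong : {u v : Lin X} → u ∼ v → bind φ u ∼ bind φ v
    bind-cong ∼-refl          = ∼-refl
    bind-cong (∼-sym p)       = ∼-sym (bind-cong p)
    bind-cong (∼-trans p q)   = ∼-trans (bind-cong p) (bind-cong q)
    bind-cong (∼-++ {u} {u′} {v} {v′} p q) = begin
      bind φ (u ++ v)             ≡⟨ bind-++ φ u v ⟩
      bind φ u ++ bind φ v        ≈⟨ ∼-++ (bind-cong p) (bind-cong q) ⟩
      bind φ u′ ++ bind φ v′      ≡⟨ bind-++ φ u′ v′ ⟨
      bind φ (u′ ++ v′)           ∎
      where open ∼-Reasoning
    bind-cong (∼-comm u v)    = begin
      bind φ (u ++ v)        ≡⟨ bind-++ φ u v ⟩
      bind φ u ++ bind φ v   ≈⟨ ∼-comm (bind φ u) (bind φ v) ⟩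
      bind φ v ++ bind φ u   ≡⟨ bind-++ φ v u ⟨
      bind φ (v ++ u)        ∎
      where open ∼-Reasoning
    bind-cong (∼-zero x)      = ∼-trans (∼-identityʳ _) (φ-0# x)
    bind-cong (∼-add a a′ x)  = ∼-trans (∼-sym (∼-assoc (φ a x) (φ a′ x) [])) (∼-++ʳ [] (φ-+ a a′ x))
    bind-cong (∼-coeff x p)   = ∼-++ʳ [] (φ-coeff x p)

  infixl 6 _>>=_
  _>>=_ : {X Y : Set} → Lin X → (X → Lin Y) → Lin Y
  u >>= f = bind (λ a x → scale a (f x)) u

  pure : {X : Set} → X → Lin X
  pure x = (1# , x) ∷ []

  module _ {X Y : Set} where
    >>=-cong : (f : X → Lin Y) {u v : Lin X} → u ∼ v → u >>= f ∼ v >>= f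
    >>=-cong f = bind-cong (λ a x → scale a (f x)) (λ x → scale-0# (f x)) (λ a a′ x → scale-+ a a′ (f x))
                           (λ x → scale-≈ (f x))

    >>=-ext : {f g : X → Lin Y} → (∀ x → f x ∼ g x) → (u : Lin X) → u >>= f ∼ u >>= g
    >>=-ext f∼g []            = ∼-refl
    >>=-ext f∼g ((a , x) ∷ u) = ∼-++ (scale-cong a (f∼g x)) (>>=-ext f∼g u)

    >>=-ext≡ : {f g : X → Lin Y} → (∀ x → f x ≡ g x) → (u : Lin X) → u >>= f ≡ u >>= g
    >>=-ext≡ f≗g []            = refl
    >>=-ext≡ f≗g ((a , x) ∷ u) = cong₂ (λ p q → scale a p ++ q) (f≗g x) (>>=-ext≡ f≗g u)

    >>=-++ : (f : X → Lin Y) (u v : Lin X) → (u ++ v) >>= f ≡ u >>= f ++ v >>= f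
    >>=-++ f = bind-++ (λ a x → scale a (f x))

    >>=-scale : (f : X → Lin Y) (a : Carrier) (u : Lin X) → scale a u >>= f ∼ scale a (u >>= f)
    >>=-scale f a []            = ∼-refl
    >>=-scale f a ((b , x) ∷ u) =
      ∼-trans (∼-++ (∼-sym (scale-scale a b (f x))) (>>=-scale f a u))
              (≡⇒∼ (sym (scale-++ a (scale b (f x)) (u >>= f))))

    scale->>= : (f : X → Lin Y) (a : Carrier) (u : Lin X) → scale a (u >>= f) ∼ u >>= scale a ∘ f
    scale->>= f a []            = ∼-refl
    scale->>= f a ((b , x) ∷ u) =
      ∼-trans (≡⇒∼ (scale-++ a (scale b (f x)) (u >>= f))) (∼-++ (scale-comm a b (f x)) (scale->>= f a u))

    >>=-distrib : (f g : X → Lin Y) (u : Lin X) → u >>= (λ x → f x ++ g x) ∼ u >>= f ++ u >>= g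
    >>=-distrib f g []            = ∼-refl
    >>=-distrib f g ((a , x) ∷ u) =
      ∼-trans (∼-++ (≡⇒∼ (scale-++ a (f x) (g x))) (>>=-distrib f g u))
              (∼-interchange (scale a (f x)) (scale a (g x)) (u >>= f) (u >>= g))

    >>=-singleton : (f : X → Lin Y) (a : Carrier) (x : X) → ((a , x) ∷ []) >>= f ∼ scale a (f x)
    >>=-singleton f a x = ∼-identityʳ _

    >>=-[] : (u : Lin X) → u >>= (λ _ → [] {A = Carrier × Y}) ≡ []
    >>=-[] []      = refl
    >>=-[] (x ∷ u) = >>=-[] u

    mapL-as->>= : (g : X → Y) (u : Lin X) → mapL g u ∼ u >>= pure ∘ g
    mapL-as->>= g []            = ∼-refl
    mapL-as->>= g ((a , x) ∷ u) = ∼-++ (∼-coeff (g x) (≈-sym (*-identityʳ a))) (mapL-as->>= g u)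

  >>=-pure : {X : Set} (u : Lin X) → u >>= pure ∼ u
  >>=-pure u = ∼-trans (∼-sym (mapL-as->>= id u)) (≡⇒∼ (mapL-id u))

  >>=-mapL : {X Y Z : Set} (f : Y → Lin Z) (g : X → Y) (u : Lin X) → mapL g u >>= f ≡ u >>= f ∘ g
  >>=-mapL f g []            = refl
  >>=-mapL f g ((a , x) ∷ u) = cong (scale a (f (g x)) ++_) (>>=-mapL f g u)

  mapL->>= : {X Y Z : Set} (h : Y → Z) (f : X → Lin Y) (u : Lin X) → mapL h (u >>= f) ≡ u >>= mapL h ∘ f
  mapL->>= h f []            = refl
  mapL->>= h f ((a , x) ∷ u) =
    trans (mapL-++ h (scale a (f x)) (u >>= f)) (cong₂ _++_ (mapL-scale h a (f x)) (mapL->>= h f u))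

  >>=-assoc : {X Y Z : Set} (g : Y → Lin Z) (f : X → Lin Y) (u : Lin X) →
              u >>= f >>= g ∼ u >>= (λ x → f x >>= g)
  >>=-assoc g f []            = ∼-refl
  >>=-assoc g f ((a , x) ∷ u) =
    ∼-trans (≡⇒∼ (>>=-++ g (scale a (f x)) (u >>= f))) (∼-++ (>>=-scale g a (f x)) (>>=-assoc g f u))

  >>=-comm : {X Y Z : Set} (F : X → Y → Lin Z) (u : Lin X) (v : Lin Y) →
             u >>= (λ x → v >>= F x) ∼ v >>= (λ y → u >>= λ x → F x y)
  >>=-comm F []            v = ≡⇒∼ (sym (>>=-[] v))
  >>=-comm F ((a , x) ∷ u) v =
    ∼-trans (∼-++ (scale->>= (F x) a v) (>>=-comm F u v))
            (∼-sym (>>=-distrib (λ y → scale a (F x y)) (λ y → u >>= λ x′ → F x′ y) v))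

  >>=-mapL-comm : {X Y Z : Set} (h : X → Y → Z) (u : Lin X) (v : Lin Y) →
                  u >>= (λ x → mapL (h x) v) ∼ v >>= (λ y → mapL (λ x → h x y) u)
  >>=-mapL-comm h u v = begin
    u >>= (λ x → mapL (h x) v)                      ≈⟨ >>=-ext (λ x → mapL-as->>= (h x) v) u ⟩
    u >>= (λ x → v >>= λ y → pure (h x y))          ≈⟨ >>=-comm (λ x y → pure (h x y)) u v ⟩
    v >>= (λ y → u >>= λ x → pure (h x y))          ≈⟨ >>=-ext (λ y → mapL-as->>= (λ x → h x y) u) v ⟨
    v >>= (λ y → mapL (λ x → h x y) u)              ∎
    where open ∼-Reasoning

  mapL-++₃ : {X Y : Set} (f : X → Y) (a : Carrier) (u v w : Lin X) →
             mapL f (u ++ v ++ scale a w) ≡ mapL f u ++ mapL f v ++ scale a (mapL f w)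
  mapL-++₃ f a u v w =
    trans (mapL-++ f u _) (cong (mapL f u ++_) (trans (mapL-++ f v _) (cong (mapL f v ++_) (mapL-scale f a w))))

  mapL-commute : {X Y Y′ Z : Set} {f : Y → Z} {g : X → Y} {f′ : Y′ → Z} {g′ : X → Y′} →
                 (∀ x → f (g x) ≡ f′ (g′ x)) → (u : Lin X) → mapL f (mapL g u) ≡ mapL f′ (mapL g′ u)
  mapL-commute {f = f} {g} {f′} {g′} square u =
    trans (mapL-∘ f g u) (trans (mapL-ext square u) (sym (mapL-∘ f′ g′ u)))

  mapL-after-cong : {X X′ Y Z : Set} (k : Y → Z) (u : Lin X) (v : Lin X′) {f : X → Lin Y} {g : X′ → Lin Y} →
                    u >>= f ∼ v >>= g → u >>= mapL k ∘ f ∼ v >>= mapL k ∘ g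
  mapL-after-cong k u v {f} {g} p =
    ∼-trans (≡⇒∼ (sym (mapL->>= k f u))) (∼-trans (mapL-cong k p) (≡⇒∼ (mapL->>= k g v)))

  module _ {X Y : Set} (a : Carrier) where
    >>=-distrib₃ : (f g h : X → Lin Y) (u : Lin X) →
                   u >>= (λ x → f x ++ g x ++ scale a (h x)) ∼ u >>= f ++ u >>= g ++ scale a (u >>= h)
    >>=-distrib₃ f g h u =
      ∼-trans (>>=-distrib f _ u)
        (∼-++ˡ (u >>= f) (∼-trans (>>=-distrib g _ u) (∼-++ˡ (u >>= g) (∼-sym (scale->>= h a u)))))

    >>=-++₃ : (f : X → Lin Y) (u v w : Lin X) →
              (u ++ v ++ scale a w) >>= f ∼ u >>= f ++ v >>= f ++ scale a (w >>= f)
    >>=-++₃ f u v w = begin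
      (u ++ v ++ scale a w) >>= f              ≡⟨ >>=-++ f u _ ⟩
      u >>= f ++ (v ++ scale a w) >>= f        ≡⟨ cong (u >>= f ++_) (>>=-++ f v _) ⟩
      u >>= f ++ v >>= f ++ scale a w >>= f    ≈⟨ ∼-++ˡ (u >>= f) (∼-++ˡ (v >>= f) (>>=-scale f a w)) ⟩
      u >>= f ++ v >>= f ++ scale a (w >>= f)  ∎
      where open ∼-Reasoning

  module _ {X : Set} where
    open import Algebra.Solver.CommutativeMonoid (∼-commutativeMonoid {X}) using (solve; _⊜_) renaming (_⊕_ to _∙_)

    weighted-regroup : (a : Carrier) (t₁ t₂ t₃ t₄ t₅ t₆ t₇ : Lin X) →
      t₁ ++ (t₂ ++ t₃ ++ scale a t₄) ++ scale a (t₅ ++ t₆ ++ scale a t₇)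
        ∼ (t₁ ++ t₂ ++ scale a t₅) ++ t₃ ++ scale a (t₆ ++ t₄ ++ scale a t₇)
    weighted-regroup a t₁ t₂ t₃ t₄ t₅ t₆ t₇ = begin
      t₁ ++ (t₂ ++ t₃ ++ scale a t₄) ++ scale a (t₅ ++ t₆ ++ scale a t₇)
        ≡⟨ cong (λ w → t₁ ++ (t₂ ++ t₃ ++ scale a t₄) ++ w) (scale-++₃ t₅ t₆ t₇) ⟩
      t₁ ++ (t₂ ++ t₃ ++ scale a t₄) ++ (scale a t₅ ++ scale a t₆ ++ scale a (scale a t₇))
        ≈⟨ solve 7 (λ x₁ x₂ x₃ x₄ x₅ x₆ x₇ → x₁ ∙ ((x₂ ∙ (x₃ ∙ x₄)) ∙ (x₅ ∙ (x₆ ∙ x₇)))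
                                          ⊜ (x₁ ∙ (x₂ ∙ x₅)) ∙ (x₃ ∙ (x₆ ∙ (x₄ ∙ x₇))))
                 ∼-refl t₁ t₂ t₃ (scale a t₄) (scale a t₅) (scale a t₆) (scale a (scale a t₇)) ⟩
      (t₁ ++ t₂ ++ scale a t₅) ++ t₃ ++ (scale a t₆ ++ scale a t₄ ++ scale a (scale a t₇))
        ≡⟨ cong (λ w → (t₁ ++ t₂ ++ scale a t₅) ++ t₃ ++ w) (scale-++₃ t₆ t₄ t₇) ⟨
      (t₁ ++ t₂ ++ scale a t₅) ++ t₃ ++ scale a (t₆ ++ t₄ ++ scale a t₇) ∎
      where
      open ∼-Reasoning
      scale-++₃ : (u v w : Lin X) → scale a (u ++ v ++ scale a w) ≡ scale a u ++ scale a v ++ scale a (scale a w)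
      scale-++₃ u v w = trans (scale-++ a u _) (cong (scale a u ++_) (scale-++ a v _))

module ForestAlgebra {c ℓ : Level} (K : Field c ℓ) (λ′ : Field.Carrier K) where
  open Field K using (Carrier; 1#)
  open Over K using (Lin; mapL; scale)
  open Over.Diamond K λ′
  open FormalSums K

  module _ {A : Set} where
    graftProduct : Forest A → Forest A → Lin (Forest A)
    graftProduct F F′ = treeForest (B⁺ F) F′ ++ forestTree F (B⁺ F′) ++ scale λ′ (forestForest F F′)

    B⁺-⋄T-B⁺ : (F F′ : Forest A) → B⁺ F ⋄T B⁺ F′ ≡ mapL B⁺ (graftProduct F F′)
    B⁺-⋄T-B⁺ F F′ =
      sym (mapL-++₃ B⁺ λ′ (treeForest (B⁺ F) F′) (forestTree F (B⁺ F′)) (forestForest F F′))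

    ⋄T-identityʳ : (T : Tree A) → T ⋄T • ≡ pure T
    ⋄T-identityʳ •      = refl
    ⋄T-identityʳ (B⁺ F) = refl

    B⁺-⋄T-B⁺->>= : {X : Set} (u : Lin X) (f g : X → Forest A) →
                   u >>= (λ x → B⁺ (f x) ⋄T B⁺ (g x)) ≡ mapL B⁺ (u >>= λ x → graftProduct (f x) (g x))
    B⁺-⋄T-B⁺->>= u f g =
      trans (>>=-ext≡ (λ x → B⁺-⋄T-B⁺ (f x) (g x)) u) (sym (mapL->>= B⁺ (λ x → graftProduct (f x) (g x)) u))

    mutual
      assoc-TTT : (t u v : Tree A) → (t ⋄T u) >>= (_⋄T v) ∼ (u ⋄T v) >>= (t ⋄T_)
      assoc-TTT • u v =
        ∼-trans (>>=-singleton (_⋄T v) 1# u) (∼-trans (scale-1# (u ⋄T v)) (∼-sym (>>=-pure (u ⋄T v))))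
      assoc-TTT (B⁺ F) • v =
        ∼-trans (>>=-singleton (_⋄T v) 1# (B⁺ F)) (∼-sym (>>=-singleton (B⁺ F ⋄T_) 1# v))
      assoc-TTT (B⁺ F) (B⁺ G) • = begin
        (B⁺ F ⋄T B⁺ G) >>= (_⋄T •)  ≡⟨ >>=-ext≡ ⋄T-identityʳ (B⁺ F ⋄T B⁺ G) ⟩
        (B⁺ F ⋄T B⁺ G) >>= pure     ≈⟨ >>=-pure (B⁺ F ⋄T B⁺ G) ⟩
        B⁺ F ⋄T B⁺ G               ≈⟨ scale-1# (B⁺ F ⋄T B⁺ G) ⟨
        scale 1# (B⁺ F ⋄T B⁺ G)    ≈⟨ >>=-singleton (B⁺ F ⋄T_) 1# (B⁺ G) ⟨
        (B⁺ G ⋄T •) >>= (B⁺ F ⋄T_)  ∎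
        where open ∼-Reasoning
      assoc-TTT (B⁺ F) (B⁺ G) (B⁺ H) = begin
        (B⁺ F ⋄T B⁺ G) >>= (_⋄T B⁺ H)
          ≡⟨ cong (_>>= (_⋄T B⁺ H)) (B⁺-⋄T-B⁺ F G) ⟩
        mapL B⁺ (graftProduct F G) >>= (_⋄T B⁺ H)
          ≡⟨ >>=-mapL (_⋄T B⁺ H) B⁺ (graftProduct F G) ⟩
        graftProduct F G >>= (λ x → B⁺ x ⋄T B⁺ H)
          ≡⟨ B⁺-⋄T-B⁺->>= (graftProduct F G) id (λ _ → H) ⟩
        mapL B⁺ (graftProduct F G >>= λ x → graftProduct x H)
          ≈⟨ mapL-cong B⁺ (assoc-graftProduct F G H) ⟩
        mapL B⁺ (graftProduct G H >>= graftProduct F)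
          ≡⟨ B⁺-⋄T-B⁺->>= (graftProduct G H) (λ _ → F) id ⟨
        graftProduct G H >>= (λ y → B⁺ F ⋄T B⁺ y)
          ≡⟨ >>=-mapL (B⁺ F ⋄T_) B⁺ (graftProduct G H) ⟨
        mapL B⁺ (graftProduct G H) >>= (B⁺ F ⋄T_)
          ≡⟨ cong (_>>= (B⁺ F ⋄T_)) (B⁺-⋄T-B⁺ G H) ⟨
        (B⁺ G ⋄T B⁺ H) >>= (B⁺ F ⋄T_)
          ∎
        where open ∼-Reasoning

      assoc-graftProduct : (F G H : Forest A) →
                           graftProduct F G >>= (λ x → graftProduct x H) ∼ graftProduct G H >>= graftProduct F
      assoc-graftProduct F G H = begin
        graftProduct F G >>= (λ x → graftProduct x H)
          ≈⟨ >>=-distrib₃ λ′ (λ x → treeForest (B⁺ x) H) (λ x → forestTree x (B⁺ H)) (λ x → forestForest x H)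
                          (graftProduct F G) ⟩
        graftProduct F G >>= (λ x → treeForest (B⁺ x) H) ++ graftProduct F G >>= (λ x → forestTree x (B⁺ H))
          ++ scale λ′ (graftProduct F G >>= λ x → forestForest x H)
          ≈⟨ ∼-++ outer (∼-++ middleˡ (scale-cong λ′ innerˡ)) ⟩
        t₁ ++ (t₂ ++ t₃ ++ scale λ′ t₄) ++ scale λ′ (t₅ ++ t₆ ++ scale λ′ t₇)
          ≈⟨ weighted-regroup λ′ t₁ t₂ t₃ t₄ t₅ t₆ t₇ ⟩
        (t₁ ++ t₂ ++ scale λ′ t₅) ++ t₃ ++ scale λ′ (t₆ ++ t₄ ++ scale λ′ t₇)
          ≈⟨ ∼-++ outerʳ (∼-++ (≡⇒∼ middleʳ) (scale-cong λ′ innerʳ)) ⟨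
        graftProduct G H >>= treeForest (B⁺ F) ++ graftProduct G H >>= (λ y → forestTree F (B⁺ y))
          ++ scale λ′ (graftProduct G H >>= forestForest F)
          ≈⟨ >>=-distrib₃ λ′ (treeForest (B⁺ F)) (λ y → forestTree F (B⁺ y)) (forestForest F) (graftProduct G H) ⟨
        graftProduct G H >>= graftProduct F
          ∎
        where
        open ∼-Reasoning
        t₁ t₂ t₃ t₄ t₅ t₆ t₇ : Lin (Forest A)
        t₁ = treeForest (B⁺ G) H >>= treeForest (B⁺ F)
        t₂ = forestTree G (B⁺ H) >>= treeForest (B⁺ F)
        t₃ = (B⁺ G ⋄T B⁺ H) >>= forestTree F
        t₄ = forestTree G (B⁺ H) >>= forestForest F
        t₅ = forestForest G H >>= treeForest (B⁺ F)
        t₆ = treeForest (B⁺ G) H >>= forestForest F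
        t₇ = forestForest G H >>= forestForest F
        outer : graftProduct F G >>= (λ x → treeForest (B⁺ x) H) ∼ t₁
        outer = ∼-trans (≡⇒∼ (trans (sym (>>=-mapL (λ t → treeForest t H) B⁺ (graftProduct F G)))
                                    (cong (_>>= λ t → treeForest t H) (sym (B⁺-⋄T-B⁺ F G)))))
                        (assoc-TTF (B⁺ F) (B⁺ G) H)
        middleˡ : graftProduct F G >>= (λ x → forestTree x (B⁺ H)) ∼ t₂ ++ t₃ ++ scale λ′ t₄
        middleˡ = ∼-trans (>>=-++₃ λ′ (λ x → forestTree x (B⁺ H)) (treeForest (B⁺ F) G) (forestTree F (B⁺ G))
                                    (forestForest F G))
                          (∼-++ (assoc-TFT (B⁺ F) G (B⁺ H))
                                (∼-++ (assoc-FTT F (B⁺ G) (B⁺ H)) (scale-cong λ′ (assoc-FFT F G (B⁺ H)))))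
        innerˡ : graftProduct F G >>= (λ x → forestForest x H) ∼ t₅ ++ t₆ ++ scale λ′ t₇
        innerˡ = ∼-trans (>>=-++₃ λ′ (λ x → forestForest x H) (treeForest (B⁺ F) G) (forestTree F (B⁺ G))
                                   (forestForest F G))
                         (∼-++ (assoc-TFF (B⁺ F) G H) (∼-++ (assoc-FTF F (B⁺ G) H) (scale-cong λ′ (assoc-FFF F G H))))
        outerʳ : graftProduct G H >>= treeForest (B⁺ F) ∼ t₁ ++ t₂ ++ scale λ′ t₅
        outerʳ = >>=-++₃ λ′ (treeForest (B⁺ F)) (treeForest (B⁺ G) H) (forestTree G (B⁺ H)) (forestForest G H)
        middleʳ : graftProduct G H >>= (λ y → forestTree F (B⁺ y)) ≡ t₃
        middleʳ = trans (sym (>>=-mapL (forestTree F) B⁺ (graftProduct G H)))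
                        (cong (_>>= forestTree F) (sym (B⁺-⋄T-B⁺ G H)))
        innerʳ : graftProduct G H >>= forestForest F ∼ t₆ ++ t₄ ++ scale λ′ t₇
        innerʳ = >>=-++₃ λ′ (forestForest F) (treeForest (B⁺ G) H) (forestTree G (B⁺ H)) (forestForest G H)

      assoc-TTF : (t u : Tree A) (H : Forest A) →
                  (t ⋄T u) >>= (λ s → treeForest s H) ∼ treeForest u H >>= treeForest t
      assoc-TTF t u [ v ] =
        ∼-trans (mapL-after-cong [_] (t ⋄T u) (u ⋄T v) (assoc-TTT t u v))
                (≡⇒∼ (sym (>>=-mapL (treeForest t) [_] (u ⋄T v))))
      assoc-TTF t u (v ⟨ z ⟩ H) =
        ∼-trans (mapL-after-cong (_⟨ z ⟩ H) (t ⋄T u) (u ⋄T v) (assoc-TTT t u v))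
                (≡⇒∼ (sym (>>=-mapL (treeForest t) (_⟨ z ⟩ H) (u ⋄T v))))

      assoc-TFT : (t : Tree A) (G : Forest A) (v : Tree A) →
                  treeForest t G >>= (λ x → forestTree x v) ∼ forestTree G v >>= treeForest t
      assoc-TFT t [ u ] v =
        ∼-trans (≡⇒∼ (>>=-mapL (λ x → forestTree x v) [_] (t ⋄T u)))
          (∼-trans (mapL-after-cong [_] (t ⋄T u) (u ⋄T v) (assoc-TTT t u v))
                   (≡⇒∼ (sym (>>=-mapL (treeForest t) [_] (u ⋄T v)))))
      assoc-TFT t (u ⟨ y ⟩ G) v =
        ∼-trans (≡⇒∼ (>>=-mapL (λ x → forestTree x v) (_⟨ y ⟩ G) (t ⋄T u)))
          (∼-trans (>>=-mapL-comm (_⟨ y ⟩_) (t ⋄T u) (forestTree G v))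
                   (≡⇒∼ (sym (>>=-mapL (treeForest t) (u ⟨ y ⟩_) (forestTree G v)))))

      assoc-TFF : (t : Tree A) (G H : Forest A) →
                  treeForest t G >>= (λ x → forestForest x H) ∼ forestForest G H >>= treeForest t
      assoc-TFF t [ u ] H =
        ∼-trans (≡⇒∼ (>>=-mapL (λ x → forestForest x H) [_] (t ⋄T u))) (assoc-TTF t u H)
      assoc-TFF t (u ⟨ y ⟩ G) H =
        ∼-trans (≡⇒∼ (>>=-mapL (λ x → forestForest x H) (_⟨ y ⟩ G) (t ⋄T u)))
          (∼-trans (>>=-mapL-comm (_⟨ y ⟩_) (t ⋄T u) (forestForest G H))
                   (≡⇒∼ (sym (>>=-mapL (treeForest t) (u ⟨ y ⟩_) (forestForest G H)))))

      assoc-FTT : (F : Forest A) (u v : Tree A) →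
                  forestTree F u >>= (λ x → forestTree x v) ∼ (u ⋄T v) >>= forestTree F
      assoc-FTT [ t ] u v =
        ∼-trans (≡⇒∼ (>>=-mapL (λ x → forestTree x v) [_] (t ⋄T u)))
                (mapL-after-cong [_] (t ⋄T u) (u ⋄T v) (assoc-TTT t u v))
      assoc-FTT (t ⟨ x ⟩ F) u v =
        ∼-trans (≡⇒∼ (>>=-mapL (λ z → forestTree z v) (t ⟨ x ⟩_) (forestTree F u)))
                (mapL-after-cong (t ⟨ x ⟩_) (forestTree F u) (u ⋄T v) (assoc-FTT F u v))

      assoc-FTF : (F : Forest A) (u : Tree A) (H : Forest A) →
                  forestTree F u >>= (λ x → forestForest x H) ∼ treeForest u H >>= forestForest F
      assoc-FTF [ t ] u H =
        ∼-trans (≡⇒∼ (>>=-mapL (λ x → forestForest x H) [_] (t ⋄T u))) (assoc-TTF t u H)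
      assoc-FTF (t ⟨ x ⟩ F) u H =
        ∼-trans (≡⇒∼ (>>=-mapL (λ z → forestForest z H) (t ⟨ x ⟩_) (forestTree F u)))
                (mapL-after-cong (t ⟨ x ⟩_) (forestTree F u) (treeForest u H) (assoc-FTF F u H))

      assoc-FFT : (F G : Forest A) (v : Tree A) →
                  forestForest F G >>= (λ x → forestTree x v) ∼ forestTree G v >>= forestForest F
      assoc-FFT [ t ] G v = assoc-TFT t G v
      assoc-FFT (t ⟨ x ⟩ F) G v =
        ∼-trans (≡⇒∼ (>>=-mapL (λ z → forestTree z v) (t ⟨ x ⟩_) (forestForest F G)))
                (mapL-after-cong (t ⟨ x ⟩_) (forestForest F G) (forestTree G v) (assoc-FFT F G v))

      assoc-FFF : (F G H : Forest A) →
                  forestForest F G >>= (λ x → forestForest x H) ∼ forestForest G H >>= forestForest F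
      assoc-FFF [ t ] G H = assoc-TFF t G H
      assoc-FFF (t ⟨ x ⟩ F) G H =
        ∼-trans (≡⇒∼ (>>=-mapL (λ z → forestForest z H) (t ⟨ x ⟩_) (forestForest F G)))
                (mapL-after-cong (t ⟨ x ⟩_) (forestForest F G) (forestForest G H) (assoc-FFF F G H))

    forestForest-identityˡ : (G : Forest A) → forestForest [ • ] G ≡ pure G
    forestForest-identityˡ [ T ]       = refl
    forestForest-identityˡ (T ⟨ y ⟩ G) = refl

    forestForest-identityʳ : (F : Forest A) → forestForest F [ • ] ≡ pure F
    forestForest-identityʳ [ • ]       = refl
    forestForest-identityʳ [ B⁺ F ]    = refl
    forestForest-identityʳ (T ⟨ x ⟩ F) = cong (mapL (T ⟨ x ⟩_)) (forestForest-identityʳ F)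

    forestForest-[]ʳ : (F : Forest A) (T : Tree A) → forestForest F [ T ] ≡ forestTree F T
    forestForest-[]ʳ [ T₀ ]       T = refl
    forestForest-[]ʳ (T₀ ⟨ x ⟩ F) T = cong (mapL (T₀ ⟨ x ⟩_)) (forestForest-[]ʳ F T)

  module _ {m n : ℕ} where
    joinedProduct : Forest (Fin m) → Forest (Fin n) → Lin (Forest (Fin (m +ℕ n)))
    joinedProduct F G = mapL (mapF (join m n)) (forestForest (mapF inj₁ F) (mapF inj₂ G))

    joinedProduct-word : (F : Forest (Fin m)) (G : Forest (Fin n)) (H : Forest (Fin m ⊎ Fin n)) →
                         decsF H ≡ decsF (mapF inj₁ F) ++ decsF (mapF inj₂ G) →
                         decsF (mapF (join m n) H) ≡ joinWord (decsF F) (decsF G)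
    joinedProduct-word F G H d = begin
      decsF (mapF (join m n) H)                                  ≡⟨ decsF-map (join m n) H ⟩
      map (join m n) (decsF H)                                   ≡⟨ cong (map (join m n)) d ⟩
      map (join m n) (decsF (mapF inj₁ F) ++ decsF (mapF inj₂ G))
        ≡⟨ cong (map (join m n)) (cong₂ _++_ (decsF-map inj₁ F) (decsF-map inj₂ G)) ⟩
      map (join m n) (map inj₁ (decsF F) ++ map inj₂ (decsF G))
        ≡⟨ map-++-map (join m n) inj₁ inj₂ (decsF F) (decsF G) ⟩
      joinWord (decsF F) (decsF G)                               ∎
      where open ≡-Reasoning

    joinedProduct-decs : (F : Forest (Fin m)) (G : Forest (Fin n)) →
                         All (λ t → decsF (proj₂ t) ≡ joinWord (decsF F) (decsF G)) (joinedProduct F G)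
    joinedProduct-decs F G =
      Allₚ.map⁺ (All.map (λ {t} → joinedProduct-word F G (proj₂ t)) (ff-decs (mapF inj₁ F) (mapF inj₂ G)))

  module _ {X Y : Set} (g : X → Y) where
    mutual
      ⋄T-natural : (T T′ : Tree X) → mapL (mapT g) (T ⋄T T′) ≡ mapT g T ⋄T mapT g T′
      ⋄T-natural •      T′      = refl
      ⋄T-natural (B⁺ F) •       = refl
      ⋄T-natural (B⁺ F) (B⁺ F′) = begin
        mapL (mapT g) (B⁺ F ⋄T B⁺ F′)                  ≡⟨ cong (mapL (mapT g)) (B⁺-⋄T-B⁺ F F′) ⟩
        mapL (mapT g) (mapL B⁺ (graftProduct F F′))    ≡⟨ mapL-commute (λ _ → refl) (graftProduct F F′) ⟩
        mapL B⁺ (mapL (mapF g) (graftProduct F F′))    ≡⟨ cong (mapL B⁺) (graftProduct-natural F F′) ⟩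
        mapL B⁺ (graftProduct (mapF g F) (mapF g F′))  ≡⟨ B⁺-⋄T-B⁺ (mapF g F) (mapF g F′) ⟨
        B⁺ (mapF g F) ⋄T B⁺ (mapF g F′)                ∎
        where open ≡-Reasoning

      graftProduct-natural : (F F′ : Forest X) →
                             mapL (mapF g) (graftProduct F F′) ≡ graftProduct (mapF g F) (mapF g F′)
      graftProduct-natural F F′ =
        trans (mapL-++₃ (mapF g) λ′ (treeForest (B⁺ F) F′) (forestTree F (B⁺ F′)) (forestForest F F′))
              (cong₂ _++_ (treeForest-natural (B⁺ F) F′)
                          (cong₂ _++_ (forestTree-natural F (B⁺ F′))
                                      (cong (scale λ′) (forestForest-natural F F′))))

      treeForest-natural : (T : Tree X) (G : Forest X) →
                           mapL (mapF g) (treeForest T G) ≡ treeForest (mapT g T) (mapF g G)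
      treeForest-natural T [ T′ ]       =
        trans (mapL-commute (λ _ → refl) (T ⋄T T′)) (cong (mapL [_]) (⋄T-natural T T′))
      treeForest-natural T (T′ ⟨ y ⟩ G) =
        trans (mapL-commute (λ _ → refl) (T ⋄T T′)) (cong (mapL (_⟨ g y ⟩ mapF g G)) (⋄T-natural T T′))

      forestTree-natural : (F : Forest X) (T : Tree X) →
                           mapL (mapF g) (forestTree F T) ≡ forestTree (mapF g F) (mapT g T)
      forestTree-natural [ T₀ ]       T =
        trans (mapL-commute (λ _ → refl) (T₀ ⋄T T)) (cong (mapL [_]) (⋄T-natural T₀ T))
      forestTree-natural (T₀ ⟨ x ⟩ F) T =
        trans (mapL-commute (λ _ → refl) (forestTree F T))
              (cong (mapL (mapT g T₀ ⟨ g x ⟩_)) (forestTree-natural F T))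

      forestForest-natural : (F G : Forest X) → mapL (mapF g) (forestForest F G) ≡ forestForest (mapF g F) (mapF g G)
      forestForest-natural [ T₀ ]       G = treeForest-natural T₀ G
      forestForest-natural (T₀ ⟨ x ⟩ F) G =
        trans (mapL-commute (λ _ → refl) (forestForest F G))
              (cong (mapL (mapT g T₀ ⟨ g x ⟩_)) (forestForest-natural F G))

  forestForest-relabel : {X Y : Set} (r : X → Y) {F G : Forest X} {F′ G′ : Forest Y} →
                         mapF r F ≡ F′ → mapF r G ≡ G′ → forestForest F′ G′ ≡ mapL (mapF r) (forestForest F G)
  forestForest-relabel r {F} {G} refl refl = sym (forestForest-natural r F G)

  mapL-mapF-∘ : {X Y Z : Set} (f : Y → Z) (g : X → Y) (u : Lin (Forest X)) →
                mapL (mapF f) (mapL (mapF g) u) ≡ mapL (mapF (f ∘ g)) u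
  mapL-mapF-∘ f g u = trans (mapL-∘ (mapF f) (mapF g) u) (mapL-ext (mapF-∘ f g) u)

  joinedProduct-relabel : ∀ {m n} {X : Set} (r : X → Fin m ⊎ Fin n)
    {F : Forest (Fin m)} {G : Forest (Fin n)} {F′ G′ : Forest X} →
    mapF r F′ ≡ mapF inj₁ F → mapF r G′ ≡ mapF inj₂ G →
    joinedProduct F G ≡ mapL (mapF (join m n ∘ r)) (forestForest F′ G′)
  joinedProduct-relabel {m} {n} r F≡ G≡ =
    trans (cong (mapL (mapF (join m n))) (forestForest-relabel r F≡ G≡)) (mapL-mapF-∘ (join m n) r _)

  module _ {m n k : ℕ} (F₁ : Forest (Fin m)) (F₂ : Forest (Fin n)) (F₃ : Forest (Fin k)) where
    joinedProduct-bracketˡ : joinedProduct F₁ F₂ >>= (λ H → joinedProduct H F₃) ≡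
      mapL (mapF (assocˡ-label m n k))
           (forestForest (mapF inj₁ (mapF inj₁ F₁)) (mapF inj₁ (mapF inj₂ F₂)) >>= λ H → forestForest H (mapF inj₂ F₃))
    joinedProduct-bracketˡ = begin
      mapL (mapF (join m n)) Z >>= (λ H → joinedProduct H F₃)
        ≡⟨ >>=-mapL (λ H → joinedProduct H F₃) (mapF (join m n)) Z ⟩
      Z >>= (λ H → joinedProduct (mapF (join m n) H) F₃)
        ≡⟨ >>=-ext≡ relabelled Z ⟩
      Z >>= (λ H → mapL (mapF (assocˡ-label m n k)) (forestForest (mapF inj₁ H) (mapF inj₂ F₃)))
        ≡⟨ mapL->>= (mapF (assocˡ-label m n k)) (λ H → forestForest (mapF inj₁ H) (mapF inj₂ F₃)) Z ⟨
      mapL (mapF (assocˡ-label m n k)) (Z >>= λ H → forestForest (mapF inj₁ H) (mapF inj₂ F₃))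
        ≡⟨ cong (mapL (mapF (assocˡ-label m n k))) (>>=-mapL (λ H → forestForest H (mapF inj₂ F₃)) (mapF inj₁) Z) ⟨
      mapL (mapF (assocˡ-label m n k)) (mapL (mapF inj₁) Z >>= λ H → forestForest H (mapF inj₂ F₃))
        ≡⟨ cong (λ Z′ → mapL (mapF (assocˡ-label m n k)) (Z′ >>= λ H → forestForest H (mapF inj₂ F₃)))
                (forestForest-relabel inj₁ {mapF inj₁ F₁} {mapF inj₂ F₂} refl refl) ⟨
      mapL (mapF (assocˡ-label m n k))
           (forestForest (mapF inj₁ (mapF inj₁ F₁)) (mapF inj₁ (mapF inj₂ F₂)) >>= λ H → forestForest H (mapF inj₂ F₃)) ∎
      where
      open ≡-Reasoning
      Z : Lin (Forest (Fin m ⊎ Fin n))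
      Z = forestForest (mapF inj₁ F₁) (mapF inj₂ F₂)
      relabelled : ∀ H → joinedProduct (mapF (join m n) H) F₃
                         ≡ mapL (mapF (assocˡ-label m n k)) (forestForest (mapF inj₁ H) (mapF inj₂ F₃))
      relabelled H = joinedProduct-relabel (⊎.map (join m n) id)
        (trans (mapF-∘ _ inj₁ H) (sym (mapF-∘ inj₁ (join m n) H))) (mapF-∘ _ inj₂ F₃)

    joinedProduct-bracketʳ : joinedProduct F₂ F₃ >>= joinedProduct F₁ ≡
      mapL (mapF (assocʳ-label m n k))
           (forestForest (mapF inj₁ (mapF inj₂ F₂)) (mapF inj₂ F₃) >>= forestForest (mapF inj₁ (mapF inj₁ F₁)))
    joinedProduct-bracketʳ = begin
      mapL (mapF (join n k)) Z >>= joinedProduct F₁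
        ≡⟨ >>=-mapL (joinedProduct F₁) (mapF (join n k)) Z ⟩
      Z >>= (λ H → joinedProduct F₁ (mapF (join n k) H))
        ≡⟨ >>=-ext≡ relabelled Z ⟩
      Z >>= (λ H → mapL (mapF (assocʳ-label m n k)) (forestForest A₁ (mapF t H)))
        ≡⟨ mapL->>= (mapF (assocʳ-label m n k)) (λ H → forestForest A₁ (mapF t H)) Z ⟨
      mapL (mapF (assocʳ-label m n k)) (Z >>= λ H → forestForest A₁ (mapF t H))
        ≡⟨ cong (mapL (mapF (assocʳ-label m n k))) (>>=-mapL (forestForest A₁) (mapF t) Z) ⟨
      mapL (mapF (assocʳ-label m n k)) (mapL (mapF t) Z >>= forestForest A₁)
        ≡⟨ cong (λ Z′ → mapL (mapF (assocʳ-label m n k)) (Z′ >>= forestForest A₁))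
                (forestForest-relabel t (trans (mapF-∘ t inj₁ F₂) (sym (mapF-∘ inj₁ inj₂ F₂))) (mapF-∘ t inj₂ F₃)) ⟨
      mapL (mapF (assocʳ-label m n k)) (forestForest (mapF inj₁ (mapF inj₂ F₂)) (mapF inj₂ F₃) >>= forestForest A₁) ∎
      where
      open ≡-Reasoning
      Z : Lin (Forest (Fin n ⊎ Fin k))
      Z = forestForest (mapF inj₁ F₂) (mapF inj₂ F₃)
      A₁ : Forest ((Fin m ⊎ Fin n) ⊎ Fin k)
      A₁ = mapF inj₁ (mapF inj₁ F₁)
      t : Fin n ⊎ Fin k → (Fin m ⊎ Fin n) ⊎ Fin k
      t = [ inj₁ ∘ inj₂ , inj₂ ]′
      s : (Fin m ⊎ Fin n) ⊎ Fin k → Fin m ⊎ Fin (n +ℕ k)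
      s = [ [ inj₁ , inj₂ ∘ join n k ∘ inj₁ ]′ , inj₂ ∘ join n k ∘ inj₂ ]′
      s∘t : ∀ x → s (t x) ≡ inj₂ (join n k x)
      s∘t (inj₁ _) = refl
      s∘t (inj₂ _) = refl
      relabelled : ∀ H → joinedProduct F₁ (mapF (join n k) H)
                         ≡ mapL (mapF (assocʳ-label m n k)) (forestForest A₁ (mapF t H))
      relabelled H = joinedProduct-relabel s (trans (mapF-∘ s inj₁ _) (mapF-∘ _ inj₁ F₁))
        (trans (mapF-∘ s t H) (trans (mapF-cong s∘t H) (sym (mapF-∘ inj₂ (join n k) H))))

  joinedProduct-rotaBaxter : ∀ {m n} (F : Forest (Fin m)) (G : Forest (Fin n)) →
    joinedProduct (graft F) (graft G) ≡
      mapL graft (joinedProduct (graft F) G ++ joinedProduct F (graft G) ++ scale λ′ (joinedProduct F G))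
  joinedProduct-rotaBaxter {m} {n} F G = begin
    mapL (mapF (join m n)) (mapL [_] (B⁺ F₁ ⋄T B⁺ G₂))
      ≡⟨ cong (mapL (mapF (join m n)) ∘ mapL [_]) (B⁺-⋄T-B⁺ F₁ G₂) ⟩
    mapL (mapF (join m n)) (mapL [_] (mapL B⁺ (graftProduct F₁ G₂)))
      ≡⟨ trans (mapL-∘ _ _ _) (trans (mapL-∘ _ _ _) (sym (mapL-∘ _ _ _))) ⟩
    mapL graft (mapL (mapF (join m n)) (graftProduct F₁ G₂))
      ≡⟨ cong (mapL graft) (mapL-++₃ (mapF (join m n)) λ′ (treeForest (B⁺ F₁) G₂) (forestTree F₁ (B⁺ G₂)) _) ⟩
    mapL graft (joinedProduct (graft F) G ++ mapL (mapF (join m n)) (forestTree F₁ (B⁺ G₂))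
                ++ scale λ′ (joinedProduct F G))
      ≡⟨ cong (λ X → mapL graft (joinedProduct (graft F) G ++ mapL (mapF (join m n)) X ++ scale λ′ (joinedProduct F G)))
              (forestForest-[]ʳ F₁ (B⁺ G₂)) ⟨
    mapL graft (joinedProduct (graft F) G ++ joinedProduct F (graft G) ++ scale λ′ (joinedProduct F G)) ∎
    where
    open ≡-Reasoning
    F₁ : Forest (Fin m ⊎ Fin n)
    F₁ = mapF inj₁ F
    G₂ : Forest (Fin m ⊎ Fin n)
    G₂ = mapF inj₂ G

module Coinvariants {c ℓ : Level} (K : Field c ℓ) (λ′ : Field.Carrier K) (E : Set) where
  open Field K using (Carrier; _≈_; _+_; _*_; 0#; 1#)
  open Over K using (Lin; mapL; scale)
  open Over.Diamond K λ′ using (forestForest; ff-decs)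
  open Over.WithE K E
  open Over.WithE.Product K E λ′ using (_·₀_; _·_)
  open FormalSums K
  open ForestAlgebra K λ′

  ∼⇒≋ : {u v : Lin Basis} → u ∼ v → u ≋ v
  ∼⇒≋ ∼-refl         = ≋-refl
  ∼⇒≋ (∼-sym p)      = ≋-sym (∼⇒≋ p)
  ∼⇒≋ (∼-trans p q)  = ≋-trans (∼⇒≋ p) (∼⇒≋ q)
  ∼⇒≋ (∼-++ p q)     = ≋-++ (∼⇒≋ p) (∼⇒≋ q)
  ∼⇒≋ (∼-comm u v)   = ≋-comm u v
  ∼⇒≋ (∼-zero x)     = ≋-zero x
  ∼⇒≋ (∼-add a a′ x) = ≋-add a a′ x
  ∼⇒≋ (∼-coeff x p)  = ≋-coeff x p

  ≡⇒≋ : {u v : Lin Basis} → u ≡ v → u ≋ v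
  ≡⇒≋ refl = ≋-refl

  ≋-setoid : Setoid c (c ⊔ ℓ)
  ≋-setoid = record { Carrier = Lin Basis ; _≈_ = _≋_
                    ; isEquivalence = record { refl = ≋-refl ; sym = ≋-sym ; trans = ≋-trans } }

  module ≋-Reasoning = SetoidReasoning ≋-setoid

  ≋-mkB : ∀ a {N} {H H′ : Forest (Fin N)} {p p′} {e e′ : Vec E N} → H ≡ H′ → e ≡ e′ →
          (a , mkB N H p e) ∷ [] ≋ (a , mkB N H′ p′ e′) ∷ []
  ≋-mkB a {N} {H} {p = p} {p′} {e} refl refl = ≋-irr a N H p p′ e

  -- Relabelling along a bijection Fin N ↔ Fin N′ is an instance of ≋-orbit, because N ≡ N′.
  ≋-relabel : ∀ a {N N′} (π : Permutation N N′) (H : Forest (Fin N)) → ∀ p q (e : Vec E N) →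
              (a , mkB N H p e) ∷ [] ≋ (a , mkB N′ (mapF (π ⟨$⟩ʳ_) H) q (permute π e)) ∷ []
  ≋-relabel a π = relabel (↔⇒≡ π) π
    where
    relabel : ∀ {N N′} → N ≡ N′ → (π : Permutation N N′) (H : Forest (Fin N)) → ∀ p q (e : Vec E N) →
              (a , mkB N H p e) ∷ [] ≋ (a , mkB N′ (mapF (π ⟨$⟩ʳ_) H) q (permute π e)) ∷ []
    relabel {N} refl = ≋-orbit a N

  scale-≋ : (a : Carrier) {u v : Lin Basis} → u ≋ v → scale a u ≋ scale a v
  scale-≋ a ≋-refl                  = ≋-refl
  scale-≋ a (≋-sym p)               = ≋-sym (scale-≋ a p)
  scale-≋ a (≋-trans p q)           = ≋-trans (scale-≋ a p) (scale-≋ a q)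
  scale-≋ a (≋-++ {u} {u′} {v} {v′} p q) =
    ≋-trans (≡⇒≋ (scale-++ a u v)) (≋-trans (≋-++ (scale-≋ a p) (scale-≋ a q)) (≡⇒≋ (sym (scale-++ a u′ v′))))
  scale-≋ a (≋-comm u v)            = ∼⇒≋ (scale-cong a (∼-comm u v))
  scale-≋ a (≋-zero x)              = ∼⇒≋ (scale-cong a (∼-zero x))
  scale-≋ a (≋-add b b′ x)          = ∼⇒≋ (scale-cong a (∼-add b b′ x))
  scale-≋ a (≋-coeff x p)           = ∼⇒≋ (scale-cong a (∼-coeff x p))
  scale-≋ a (≋-orbit b n σ F p q e) = ≋-orbit (a * b) n σ F p q e
  scale-≋ a (≋-irr b n F p q e)     = ≋-irr (a * b) n F p q e

  P-≋ : {u v : Lin Basis} → u ≋ v → P u ≋ P v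
  P-≋ ≋-refl                  = ≋-refl
  P-≋ (≋-sym p)               = ≋-sym (P-≋ p)
  P-≋ (≋-trans p q)           = ≋-trans (P-≋ p) (P-≋ q)
  P-≋ (≋-++ {u} {u′} {v} {v′} p q) =
    ≋-trans (≡⇒≋ (mapL-++ P₀ u v)) (≋-trans (≋-++ (P-≋ p) (P-≋ q)) (≡⇒≋ (sym (mapL-++ P₀ u′ v′))))
  P-≋ (≋-comm u v)            = ∼⇒≋ (mapL-cong P₀ (∼-comm u v))
  P-≋ (≋-zero x)              = ∼⇒≋ (mapL-cong P₀ (∼-zero x))
  P-≋ (≋-add b b′ x)          = ∼⇒≋ (mapL-cong P₀ (∼-add b b′ x))
  P-≋ (≋-coeff x p)           = ∼⇒≋ (mapL-cong P₀ (∼-coeff x p))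
  P-≋ (≋-orbit b n σ F p q e) = ≋-orbit b n σ (graft F) p q e
  P-≋ (≋-irr b n F p q e)     = ≋-irr b n (graft F) p q e

  P-++ : ∀ u v → P (u ++ v) ≋ P u ++ P v
  P-++ u v = ≡⇒≋ (mapL-++ P₀ u v)

  P-scale : ∀ a u → P (scale a u) ≋ scale a (P u)
  P-scale a u = ≡⇒≋ (mapL-scale P₀ a u)

  record Invariant (f : Basis → Lin Basis) : Set (c ⊔ ℓ) where
    field
      orbit      : ∀ n (σ : Permutation′ n) F p q e → f (mkB n F p e) ≋ f (mkB n (mapF (σ ⟨$⟩ʳ_) F) q (permute σ e))
      irrelevant : ∀ n F p q e → f (mkB n F p e) ≋ f (mkB n F q e)

  >>=-≋ : {f : Basis → Lin Basis} → Invariant f → {u v : Lin Basis} → u ≋ v → u >>= f ≋ v >>= f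
  >>=-≋ inv ≋-refl                  = ≋-refl
  >>=-≋ inv (≋-sym p)               = ≋-sym (>>=-≋ inv p)
  >>=-≋ inv (≋-trans p q)           = ≋-trans (>>=-≋ inv p) (>>=-≋ inv q)
  >>=-≋ {f} inv (≋-++ {u} {u′} {v} {v′} p q) =
    ≋-trans (≡⇒≋ (>>=-++ f u v)) (≋-trans (≋-++ (>>=-≋ inv p) (>>=-≋ inv q)) (≡⇒≋ (sym (>>=-++ f u′ v′))))
  >>=-≋ {f} inv (≋-comm u v)        = ∼⇒≋ (>>=-cong f (∼-comm u v))
  >>=-≋ {f} inv (≋-zero x)          = ∼⇒≋ (>>=-cong f (∼-zero x))
  >>=-≋ {f} inv (≋-add a a′ x)      = ∼⇒≋ (>>=-cong f (∼-add a a′ x))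
  >>=-≋ {f} inv (≋-coeff x p)       = ∼⇒≋ (>>=-cong f (∼-coeff x p))
  >>=-≋ inv (≋-orbit a n σ F p q e) = ≋-++ (scale-≋ a (Invariant.orbit inv n σ F p q e)) ≋-refl
  >>=-≋ inv (≋-irr a n F p q e)     = ≋-++ (scale-≋ a (Invariant.irrelevant inv n F p q e)) ≋-refl

  >>=-ext≋ : {X : Set} {f g : X → Lin Basis} → (∀ x → f x ≋ g x) → (u : Lin X) → u >>= f ≋ u >>= g
  >>=-ext≋ f≋g []            = ≋-refl
  >>=-ext≋ f≋g ((a , x) ∷ u) = ≋-++ (scale-≋ a (f≋g x)) (>>=-ext≋ f≋g u)

  _≟ᴸ_ : ∀ {N} → (xs ys : List (Fin N)) → Dec (xs ≡ ys)
  _≟ᴸ_ = Listₚ.≡-dec Finₚ._≟_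

  -- Forests over Fin N become basis elements with family e; only those with decoration word L are kept,
  -- which suffices since every forest met below has a known word, and spares carrying bijectivity proofs.
  module _ {N : ℕ} (L : List (Fin N)) (pL : L ↭ allFin N) (e : Vec E N) where
    embedOne : Carrier → (H : Forest (Fin N)) → Dec (decsF H ≡ L) → Lin Basis
    embedOne a H (yes d) = (a , mkB N H (↭-trans (↭-reflexive d) pL) e) ∷ []
    embedOne a H (no _)  = []

    embed : Lin (Forest (Fin N)) → Lin Basis
    embed = bind (λ a H → embedOne a H (decsF H ≟ᴸ L))

    embedOne-mkB : ∀ a H → decsF H ≡ L → ∀ p → embedOne a H (decsF H ≟ᴸ L) ≋ (a , mkB N H p e) ∷ []
    embedOne-mkB a H d p with decsF H ≟ᴸ L
    ... | yes _  = ≋-irr a N H _ p e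
    ... | no ¬d  = ⊥-elim (¬d d)

    embed-∼ : {u v : Lin (Forest (Fin N))} → u ∼ v → embed u ∼ embed v
    embed-∼ = bind-cong _ (λ H → zeroCoeff (decsF H ≟ᴸ L)) (λ a a′ H → add a a′ (decsF H ≟ᴸ L))
                          (λ H a≈a′ → coeff a≈a′ (decsF H ≟ᴸ L))
      where
      zeroCoeff : ∀ {H} d → embedOne 0# H d ∼ []
      zeroCoeff (yes d) = ∼-zero _
      zeroCoeff (no _)  = ∼-refl
      add : ∀ a a′ {H} d → embedOne a H d ++ embedOne a′ H d ∼ embedOne (a + a′) H d
      add a a′ (yes d) = ∼-add a a′ _
      add a a′ (no _)  = ∼-refl
      coeff : ∀ {a a′ H} → a ≈ a′ → ∀ d → embedOne a H d ∼ embedOne a′ H d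
      coeff a≈a′ (yes d) = ∼-coeff _ a≈a′
      coeff a≈a′ (no _)  = ∼-refl

    embed-++ : (u v : Lin (Forest (Fin N))) → embed (u ++ v) ≡ embed u ++ embed v
    embed-++ = bind-++ _

    embed-scale : (a : Carrier) (u : Lin (Forest (Fin N))) → embed (scale a u) ≡ scale a (embed u)
    embed-scale a []            = refl
    embed-scale a ((b , H) ∷ u) = trans (cong₂ _++_ (one (decsF H ≟ᴸ L)) (embed-scale a u))
                                        (sym (scale-++ a (embedOne b H (decsF H ≟ᴸ L)) (embed u)))
      where
      one : ∀ d → embedOne (a * b) H d ≡ scale a (embedOne b H d)
      one (yes d) = refl
      one (no _)  = refl

    embed->>= : {X : Set} (f : X → Lin (Forest (Fin N))) (u : Lin X) → embed (u >>= f) ≡ u >>= embed ∘ f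
    embed->>= f []            = refl
    embed->>= f ((a , x) ∷ u) =
      trans (embed-++ (scale a (f x)) (u >>= f)) (cong₂ _++_ (embed-scale a (f x)) (embed->>= f u))

    embed-++₃ : (a : Carrier) (u v w : Lin (Forest (Fin N))) →
                embed (u ++ v ++ scale a w) ≡ embed u ++ embed v ++ scale a (embed w)
    embed-++₃ a u v w =
      trans (embed-++ u _) (cong (embed u ++_) (trans (embed-++ v _) (cong (embed v ++_) (embed-scale a w))))

    embed-graft : (u : Lin (Forest (Fin N))) → embed (mapL graft u) ≡ P (embed u)
    embed-graft []            = refl
    embed-graft ((a , H) ∷ u) = sym (trans (mapL-++ P₀ (embedOne a H (decsF H ≟ᴸ L)) (embed u))
                                           (cong₂ _++_ (one (decsF H ≟ᴸ L)) (sym (embed-graft u))))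
      where
      one : ∀ d → P (embedOne a H d) ≡ embedOne a (graft H) d
      one (yes _) = refl
      one (no _)  = refl

  module _ {m n : ℕ} (F : Forest (Fin m)) (p : decsF F ↭ allFin m) (e : Vec E m)
                     (G : Forest (Fin n)) (q : decsF G ↭ allFin n) (e′ : Vec E n) where
    -- Defs builds _·₀_ with a private helper; unification recovers the body of _·₀_ as a function
    -- of the ⋄-product and its decoration proofs, over which ·₀-embed can then recurse.
    mutual
      ·₀-body : (xs : Lin (Forest (Fin m ⊎ Fin n))) →
                All (λ t → decsF (proj₂ t) ≡ decsF (mapF inj₁ F) ++ decsF (mapF inj₂ G)) xs → Lin Basis
      ·₀-body = _

      ·₀-unfold : mkB m F p e ·₀ mkB n G q e′ ≡
                  ·₀-body (forestForest (mapF inj₁ F) (mapF inj₂ G)) (ff-decs (mapF inj₁ F) (mapF inj₂ G))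
      ·₀-unfold with forestForest (mapF inj₁ F) (mapF inj₂ G) | ff-decs (mapF inj₁ F) (mapF inj₂ G)
      ... | xs | ps = refl

    ·₀-embed : {L : List (Fin (m +ℕ n))} (pL : L ↭ allFin (m +ℕ n)) → L ≡ joinWord (decsF F) (decsF G) →
               mkB m F p e ·₀ mkB n G q e′ ≋ embed L pL (e ++ᵥ e′) (joinedProduct F G)
    ·₀-embed {L} pL L≡ = ≋-trans (≡⇒≋ ·₀-unfold) (body _ (ff-decs (mapF inj₁ F) (mapF inj₂ G)))
      where
      body : ∀ xs ps → ·₀-body xs ps ≋ embed L pL (e ++ᵥ e′) (mapL (mapF (join m n)) xs)
      body []             []        = ≋-refl
      body ((a , H) ∷ xs) (dH ∷ ps) =
        ≋-++ (≋-sym (embedOne-mkB L pL (e ++ᵥ e′) a (mapF (join m n) H) d _)) (body xs ps)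
        where
        d : decsF (mapF (join m n) H) ≡ L
        d = trans (joinedProduct-word F G H dH) (sym L≡)

  embed-relabel : {X : Set} {N N′ : ℕ} (π : Permutation N N′) {g : X → Fin N} {g′ : X → Fin N′} →
    (∀ x → g′ x ≡ π ⟨$⟩ʳ g x) →
    {L₀ : List (Fin N)} {pL₀ : L₀ ↭ allFin N} {e₀ : Vec E N}
    {L₁ : List (Fin N′)} {pL₁ : L₁ ↭ allFin N′} {e₁ : Vec E N′} →
    L₁ ≡ map (π ⟨$⟩ʳ_) L₀ → e₁ ≡ permute π e₀ → (Z : Lin (Forest X)) →
    embed L₀ pL₀ e₀ (mapL (mapF g) Z) ≋ embed L₁ pL₁ e₁ (mapL (mapF g′) Z)
  embed-relabel π {g} {g′} g′≗πg {L₀} {pL₀} {e₀} {L₁} {pL₁} {e₁} L₁≡ e₁≡ = go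
    where
    relabelled : ∀ H → mapF (π ⟨$⟩ʳ_) (mapF g H) ≡ mapF g′ H
    relabelled H = trans (mapF-∘ _ g H) (sym (mapF-cong g′≗πg H))
    word : ∀ H → decsF (mapF g′ H) ≡ map (π ⟨$⟩ʳ_) (decsF (mapF g H))
    word H = trans (cong decsF (sym (relabelled H))) (decsF-map (π ⟨$⟩ʳ_) (mapF g H))
    one : ∀ a H d₀ d₁ → embedOne L₀ pL₀ e₀ a (mapF g H) d₀ ≋ embedOne L₁ pL₁ e₁ a (mapF g′ H) d₁
    one a H (yes d₀) (yes d₁) =
      ≋-trans (≋-relabel a π (mapF g H) _ (↭-trans (↭-reflexive (trans (cong decsF (relabelled H)) d₁)) pL₁) e₀)
              (≋-mkB a (relabelled H) (sym e₁≡))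
    one a H (no _)    (no _)    = ≋-refl
    one a H (yes d₀)  (no ¬d₁)  = ⊥-elim (¬d₁ (trans (word H) (trans (cong (map _) d₀) (sym L₁≡))))
    one a H (no ¬d₀)  (yes d₁)  =
      ⊥-elim (¬d₀ (Listₚ.map-injective (⟨$⟩ʳ-injective π) (trans (sym (word H)) (trans d₁ L₁≡))))
    go : (Z : Lin (Forest _)) → embed L₀ pL₀ e₀ (mapL (mapF g) Z) ≋ embed L₁ pL₁ e₁ (mapL (mapF g′) Z)
    go []            = ≋-refl
    go ((a , H) ∷ Z) = ≋-++ (one a H (decsF (mapF g H) ≟ᴸ L₀) (decsF (mapF g′ H) ≟ᴸ L₁)) (go Z)

  module _ {m n : ℕ} where
    ·₀-irrelevant : (F : Forest (Fin m)) → ∀ p p′ e (G : Forest (Fin n)) → ∀ q q′ e′ →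
                    mkB m F p e ·₀ mkB n G q e′ ≋ mkB m F p′ e ·₀ mkB n G q′ e′
    ·₀-irrelevant F p p′ e G q q′ e′ =
      ≋-trans (·₀-embed F p e G q e′ (joinWord-↭ p q) refl) (≋-sym (·₀-embed F p′ e G q′ e′ (joinWord-↭ p q) refl))

    ·₀-≡ : {F F′ : Forest (Fin m)} {e e₁ : Vec E m} {G G′ : Forest (Fin n)} {e′ e₁′ : Vec E n} → ∀ {p p′ q q′} →
           F ≡ F′ → e ≡ e₁ → G ≡ G′ → e′ ≡ e₁′ →
           mkB m F p e ·₀ mkB n G q e′ ≋ mkB m F′ p′ e₁ ·₀ mkB n G′ q′ e₁′
    ·₀-≡ {F = F} {e = e} {G = G} {e′ = e′} {p = p} {p′ = p′} {q = q} {q′ = q′} refl refl refl refl =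
      ·₀-irrelevant F p p′ e G q q′ e′

    ·₀-equivariant : (σ : Permutation′ m) (ρ : Permutation′ n) →
      (F : Forest (Fin m)) → ∀ p p′ e → (G : Forest (Fin n)) → ∀ q q′ e′ →
      mkB m F p e ·₀ mkB n G q e′
        ≋ mkB m (mapF (σ ⟨$⟩ʳ_) F) p′ (permute σ e) ·₀ mkB n (mapF (ρ ⟨$⟩ʳ_) G) q′ (permute ρ e′)
    ·₀-equivariant σ ρ F p p′ e G q q′ e′ = begin
      mkB m F p e ·₀ mkB n G q e′
        ≈⟨ ·₀-embed F p e G q e′ (joinWord-↭ p q) refl ⟩
      embed _ (joinWord-↭ p q) (e ++ᵥ e′) (joinedProduct F G)
        ≈⟨ embed-relabel (σ ⊕ ρ) (λ x → sym (⊕-join σ ρ x)) word (sym (permute-⊕ σ ρ e e′))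
                         (forestForest (mapF inj₁ F) (mapF inj₂ G)) ⟩
      embed _ (joinWord-↭ p′ q′) (permute σ e ++ᵥ permute ρ e′)
        (mapL (mapF (join m n ∘ ⊎.map (σ ⟨$⟩ʳ_) (ρ ⟨$⟩ʳ_))) (forestForest (mapF inj₁ F) (mapF inj₂ G)))
        ≡⟨ cong (embed _ (joinWord-↭ p′ q′) _)
                (joinedProduct-relabel (⊎.map (σ ⟨$⟩ʳ_) (ρ ⟨$⟩ʳ_)) 
                   (trans (mapF-∘ _ inj₁ F) (sym (mapF-∘ inj₁ _ F))) (trans (mapF-∘ _ inj₂ G) (sym (mapF-∘ inj₂ _ G)))) ⟨
      embed _ (joinWord-↭ p′ q′) (permute σ e ++ᵥ permute ρ e′)
        (joinedProduct (mapF (σ ⟨$⟩ʳ_) F) (mapF (ρ ⟨$⟩ʳ_) G))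
        ≈⟨ ·₀-embed (mapF (σ ⟨$⟩ʳ_) F) p′ (permute σ e) (mapF (ρ ⟨$⟩ʳ_) G) q′ (permute ρ e′) (joinWord-↭ p′ q′) refl ⟨
      mkB m (mapF (σ ⟨$⟩ʳ_) F) p′ (permute σ e) ·₀ mkB n (mapF (ρ ⟨$⟩ʳ_) G) q′ (permute ρ e′) ∎
      where
      open ≋-Reasoning
      word : joinWord (decsF (mapF (σ ⟨$⟩ʳ_) F)) (decsF (mapF (ρ ⟨$⟩ʳ_) G))
             ≡ map ((σ ⊕ ρ) ⟨$⟩ʳ_) (joinWord (decsF F) (decsF G))
      word = trans (cong₂ joinWord (decsF-map _ F) (decsF-map _ G)) (sym (joinWord-⊕ σ ρ (decsF F) (decsF G)))

  ·₀-invariantˡ : (b′ : Basis) → Invariant (_·₀ b′)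
  ·₀-invariantˡ (mkB n G q e′) = record
    { orbit      = λ m σ F p p′ e →
        ≋-trans (·₀-equivariant σ idₚ F p p′ e G q q′ e′)
                (·₀-≡ {F = mapF (σ ⟨$⟩ʳ_) F} {e = permute σ e} refl refl (mapF-id G) (permute-id e′))
    ; irrelevant = λ m F p p′ e → ·₀-irrelevant F p p′ e G q q e′ }
    where
    q′ : decsF (mapF (idₚ ⟨$⟩ʳ_) G) ↭ allFin n
    q′ = ↭-trans (↭-reflexive (cong decsF (mapF-id G))) q

  ·₀-invariantʳ : (b : Basis) → Invariant (b ·₀_)
  ·₀-invariantʳ (mkB m F p e) = record
    { orbit      = λ n ρ G q q′ e′ →
        ≋-trans (·₀-equivariant idₚ ρ F p p′ e G q q′ e′)
                (·₀-≡ {G = mapF (ρ ⟨$⟩ʳ_) G} {e′ = permute ρ e′} (mapF-id F) (permute-id e) refl refl)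
    ; irrelevant = λ n G q q′ e′ → ·₀-irrelevant F p p e G q q′ e′ }
    where
    p′ : decsF (mapF (idₚ ⟨$⟩ʳ_) F) ↭ allFin m
    p′ = ↭-trans (↭-reflexive (cong decsF (mapF-id F))) p

  >>=-embed : ∀ {N} (L : List (Fin N)) (pL : L ↭ allFin N) (e : Vec E N)
              (f : Basis → Lin Basis) (h : Forest (Fin N) → Lin Basis) →
              (∀ H → decsF H ≡ L → ∀ p → f (mkB N H p e) ≋ h H) →
              (Y : Lin (Forest (Fin N))) → All (λ t → decsF (proj₂ t) ≡ L) Y → embed L pL e Y >>= f ≋ Y >>= h
  >>=-embed L pL e f h f≋h []            []       = ≋-refl
  >>=-embed L pL e f h f≋h ((a , H) ∷ Y) (d ∷ ds) =
    ≋-trans (≡⇒≋ (>>=-++ f (embedOne L pL e a H (decsF H ≟ᴸ L)) (embed L pL e Y)))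
            (≋-++ (head (decsF H ≟ᴸ L)) (>>=-embed L pL e f h f≋h Y ds))
    where
    head : ∀ dec → embedOne L pL e a H dec >>= f ≋ scale a (h H)
    head (yes _) = ≋-trans (∼⇒≋ (>>=-singleton f a _)) (scale-≋ a (f≋h H d _))
    head (no ¬d) = ⊥-elim (¬d d)

  •ᴮ : Basis
  •ᴮ = mkB 0 [ • ] (↭-reflexive refl) []ᵥ

  ·₀-identityˡ : (b : Basis) → •ᴮ ·₀ b ≋ pure b
  ·₀-identityˡ (mkB n G q e) = begin
    •ᴮ ·₀ mkB n G q e                      ≈⟨ ·₀-embed [ • ] _ []ᵥ G q e pL refl ⟩
    embed _ pL e (joinedProduct [ • ] G)   ≡⟨ cong (embed _ pL e ∘ mapL (mapF (join 0 n)))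
                                                   (forestForest-identityˡ (mapF inj₂ G)) ⟩
    embed _ pL e (pure G′)                 ≈⟨ ≋-++ (embedOne-mkB _ pL e 1# G′ word q′) ≋-refl ⟩
    (1# , mkB n G′ q′ e) ∷ []              ≈⟨ ≋-mkB 1# G′≡G refl ⟩
    pure (mkB n G q e)                     ∎
    where
    open ≋-Reasoning
    pL : joinWord [] (decsF G) ↭ allFin n
    pL = joinWord-↭ (↭-reflexive refl) q
    G′ : Forest (Fin n)
    G′ = mapF (join 0 n) (mapF inj₂ G)
    G′≡G : G′ ≡ G
    G′≡G = trans (mapF-∘ (join 0 n) inj₂ G) (mapF-id G)
    word : decsF G′ ≡ joinWord [] (decsF G)
    word = trans (cong decsF G′≡G) (sym (Listₚ.map-id (decsF G)))
    q′ : decsF G′ ↭ allFin n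
    q′ = ↭-trans (↭-reflexive (cong decsF G′≡G)) q

  -- m + 0 does not reduce to m: the product lives over Fin (m + 0) and is relabelled along a cast.
  ·₀-identityʳ : (b : Basis) → b ·₀ •ᴮ ≋ pure b
  ·₀-identityʳ (mkB m F q e) = begin
    mkB m F q e ·₀ •ᴮ
      ≈⟨ ·₀-embed F q e [ • ] _ []ᵥ pL refl ⟩
    embed _ pL (e ++ᵥ []ᵥ) (joinedProduct F [ • ])
      ≡⟨ cong (embed _ pL (e ++ᵥ []ᵥ) ∘ mapL (mapF (join m 0))) (forestForest-identityʳ (mapF inj₁ F)) ⟩
    embed _ pL (e ++ᵥ []ᵥ) (pure F′)
      ≈⟨ ≋-++ (embedOne-mkB _ pL _ 1# F′ word q′) ≋-refl ⟩
    (1# , mkB (m +ℕ 0) F′ q′ (e ++ᵥ []ᵥ)) ∷ []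
      ≈⟨ ≋-relabel 1# (cast-id m+0≡m) F′ q′ q″ (e ++ᵥ []ᵥ) ⟩
    (1# , mkB m (mapF (Fin.cast m+0≡m) F′) q″ (permute (cast-id m+0≡m) (e ++ᵥ []ᵥ))) ∷ []
      ≈⟨ ≋-mkB 1# F″≡F (trans (permute-cast-id m+0≡m (e ++ᵥ []ᵥ)) (Vecₚ.++-identityʳ-eqFree e)) ⟩
    pure (mkB m F q e) ∎
    where
    open ≋-Reasoning
    pL : joinWord (decsF F) [] ↭ allFin (m +ℕ 0)
    pL = joinWord-↭ q (↭-reflexive refl)
    m+0≡m : m +ℕ 0 ≡ m
    m+0≡m = ℕₚ.+-identityʳ m
    F′ : Forest (Fin (m +ℕ 0))
    F′ = mapF (join m 0) (mapF inj₁ F)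
    cast-↑ˡ : ∀ i → Fin.cast m+0≡m (i ↑ˡ 0) ≡ i
    cast-↑ˡ i = Finₚ.toℕ-injective (trans (Finₚ.toℕ-cast m+0≡m (i ↑ˡ 0)) (Finₚ.toℕ-↑ˡ i 0))
    F″≡F : mapF (Fin.cast m+0≡m) F′ ≡ F
    F″≡F = trans (mapF-∘ _ (join m 0) _) (trans (mapF-∘ _ inj₁ F) (trans (mapF-cong cast-↑ˡ F) (mapF-id F)))
    word : decsF F′ ≡ joinWord (decsF F) []
    word = trans (trans (decsF-map (join m 0) (mapF inj₁ F)) (cong (map (join m 0)) (decsF-map inj₁ F)))
                 (trans (sym (Listₚ.map-∘ (decsF F))) (sym (++-identityʳ _)))
    q′ : decsF F′ ↭ allFin (m +ℕ 0)
    q′ = ↭-trans (↭-reflexive word) pL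
    q″ : decsF (mapF (Fin.cast m+0≡m) F′) ↭ allFin m
    q″ = ↭-trans (↭-reflexive (cong decsF F″≡F)) q

  infixl 7 _⊙_
  _⊙_ : Lin Basis → Lin Basis → Lin Basis
  u ⊙ v = u >>= λ b → v >>= (b ·₀_)

  ·-singleton : ∀ a b v → ((a , b) ∷ []) · v ∼ scale a (v >>= (b ·₀_))
  ·-singleton a b []              = ∼-refl
  ·-singleton a b ((a′ , b′) ∷ v) = begin
    (scale (a * a′) (b ·₀ b′) ++ _) ++ []        ≡⟨ ++-assoc (scale (a * a′) (b ·₀ b′)) _ [] ⟩
    scale (a * a′) (b ·₀ b′) ++ ((a , b) ∷ []) · v
      ≈⟨ ∼-++ (∼-sym (scale-scale a a′ (b ·₀ b′))) (·-singleton a b v) ⟩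
    scale a (scale a′ (b ·₀ b′)) ++ scale a (v >>= (b ·₀_))
      ≡⟨ scale-++ a (scale a′ (b ·₀ b′)) (v >>= (b ·₀_)) ⟨
    scale a (((a′ , b′) ∷ v) >>= (b ·₀_))         ∎
    where open ∼-Reasoning

  ·∼⊙ : ∀ u v → u · v ∼ u ⊙ v
  ·∼⊙ []            v = ∼-refl
  ·∼⊙ ((a , b) ∷ u) v =
    ∼-trans (≡⇒∼ (cong (_++ u · v) (sym (++-identityʳ _)))) (∼-++ (·-singleton a b v) (·∼⊙ u v))

  ·≋⊙ : ∀ u v → u · v ≋ u ⊙ v
  ·≋⊙ u v = ∼⇒≋ (·∼⊙ u v)

  >>=-invariant : {X : Set} (f : Basis → X → Lin Basis) → (∀ x → Invariant (λ b → f b x)) → (v : Lin X) →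
                  Invariant (λ b → v >>= f b)
  >>=-invariant f inv v = record
    { orbit      = λ n σ F p q e → >>=-ext≋ (λ x → Invariant.orbit (inv x) n σ F p q e) v
    ; irrelevant = λ n F p q e → >>=-ext≋ (λ x → Invariant.irrelevant (inv x) n F p q e) v }

  ⊙-congˡ : ∀ {u u′} v → u ≋ u′ → u ⊙ v ≋ u′ ⊙ v
  ⊙-congˡ v = >>=-≋ (>>=-invariant (λ b b′ → b ·₀ b′) ·₀-invariantˡ v)

  ⊙-congʳ : ∀ u {v v′} → v ≋ v′ → u ⊙ v ≋ u ⊙ v′
  ⊙-congʳ u v≋v′ = >>=-ext≋ (λ b → >>=-≋ (·₀-invariantʳ b) v≋v′) u

  ⊙-distribˡ : ∀ u v w → u ⊙ (v ++ w) ∼ u ⊙ v ++ u ⊙ w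
  ⊙-distribˡ u v w = ∼-trans (≡⇒∼ (>>=-ext≡ (λ b → >>=-++ (b ·₀_) v w) u))
                             (>>=-distrib (λ b → v >>= (b ·₀_)) (λ b → w >>= (b ·₀_)) u)

  ⊙-distribʳ : ∀ u v w → (v ++ w) ⊙ u ≡ v ⊙ u ++ w ⊙ u
  ⊙-distribʳ u v w = >>=-++ (λ b → u >>= (b ·₀_)) v w

  ⊙-scaleˡ : ∀ a u v → scale a u ⊙ v ∼ scale a (u ⊙ v)
  ⊙-scaleˡ a u v = >>=-scale (λ b → v >>= (b ·₀_)) a u

  ⊙-scaleʳ : ∀ a u v → u ⊙ scale a v ∼ scale a (u ⊙ v)
  ⊙-scaleʳ a u v =
    ∼-trans (>>=-ext (λ b → >>=-scale (b ·₀_) a v) u) (∼-sym (scale->>= (λ b → v >>= (b ·₀_)) a u))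

  ⊙-identityˡ : ∀ u → unit ⊙ u ≋ u
  ⊙-identityˡ u = begin
    unit ⊙ u       ≈⟨ ∼⇒≋ (∼-trans (>>=-singleton (λ b → u >>= (b ·₀_)) 1# •ᴮ) (scale-1# _)) ⟩
    u >>= (•ᴮ ·₀_)  ≈⟨ >>=-ext≋ ·₀-identityˡ u ⟩
    u >>= pure      ≈⟨ ∼⇒≋ (>>=-pure u) ⟩
    u               ∎
    where open ≋-Reasoning

  ⊙-identityʳ : ∀ u → u ⊙ unit ≋ u
  ⊙-identityʳ u = begin
    u ⊙ unit        ≈⟨ ∼⇒≋ (>>=-ext (λ b → ∼-trans (>>=-singleton (b ·₀_) 1# •ᴮ) (scale-1# _)) u) ⟩
    u >>= (_·₀ •ᴮ)  ≈⟨ >>=-ext≋ ·₀-identityʳ u ⟩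
    u >>= pure      ≈⟨ ∼⇒≋ (>>=-pure u) ⟩
    u               ∎
    where open ≋-Reasoning

  ·₀-assoc : ∀ b₁ b₂ b₃ → (b₁ ·₀ b₂) >>= (_·₀ b₃) ≋ (b₂ ·₀ b₃) >>= (b₁ ·₀_)
  ·₀-assoc b₁@(mkB m F₁ p₁ e₁) b₂@(mkB n F₂ p₂ e₂) b₃@(mkB k F₃ p₃ e₃) = begin
    (b₁ ·₀ b₂) >>= (_·₀ b₃)
      ≈⟨ >>=-≋ (·₀-invariantˡ b₃) (·₀-embed F₁ p₁ e₁ F₂ p₂ e₂ p₁₂ refl) ⟩
    embed _ p₁₂ (e₁ ++ᵥ e₂) (joinedProduct F₁ F₂) >>= (_·₀ b₃)
      ≈⟨ >>=-embed _ p₁₂ (e₁ ++ᵥ e₂) (_·₀ b₃) (embed _ p₁₂,₃ ((e₁ ++ᵥ e₂) ++ᵥ e₃) ∘ λ H → joinedProduct H F₃)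
           (λ H d p → ·₀-embed H p (e₁ ++ᵥ e₂) F₃ p₃ e₃ p₁₂,₃ (cong (λ w → joinWord w (decsF F₃)) (sym d)))
           (joinedProduct F₁ F₂) (joinedProduct-decs F₁ F₂) ⟩
    joinedProduct F₁ F₂ >>= (embed _ p₁₂,₃ ((e₁ ++ᵥ e₂) ++ᵥ e₃) ∘ λ H → joinedProduct H F₃)
      ≡⟨ embed->>= _ p₁₂,₃ _ (λ H → joinedProduct H F₃) (joinedProduct F₁ F₂) ⟨
    embed _ p₁₂,₃ ((e₁ ++ᵥ e₂) ++ᵥ e₃) (joinedProduct F₁ F₂ >>= λ H → joinedProduct H F₃)
      ≡⟨ cong (embed _ p₁₂,₃ _) (joinedProduct-bracketˡ F₁ F₂ F₃) ⟩
    embed _ p₁₂,₃ ((e₁ ++ᵥ e₂) ++ᵥ e₃)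
      (mapL (mapF (assocˡ-label m n k)) (forestForest A₁ A₂ >>= λ H → forestForest H A₃))
      ≈⟨ ∼⇒≋ (embed-∼ _ p₁₂,₃ _ (mapL-cong (mapF (assocˡ-label m n k)) (assoc-FFF A₁ A₂ A₃))) ⟩
    embed _ p₁₂,₃ ((e₁ ++ᵥ e₂) ++ᵥ e₃)
      (mapL (mapF (assocˡ-label m n k)) (forestForest A₂ A₃ >>= forestForest A₁))
      ≈⟨ embed-relabel (cast-id +-assoc) (assocʳ-label≡cast m n k)
           (joinWord-assoc m n k (decsF F₁) (decsF F₂) (decsF F₃))
           (sym (trans (permute-cast-id +-assoc _) (Vecₚ.++-assoc-eqFree e₁ e₂ e₃)))
           (forestForest A₂ A₃ >>= forestForest A₁) ⟩
    embed _ p₁,₂₃ (e₁ ++ᵥ (e₂ ++ᵥ e₃))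
      (mapL (mapF (assocʳ-label m n k)) (forestForest A₂ A₃ >>= forestForest A₁))
      ≡⟨ cong (embed _ p₁,₂₃ _) (joinedProduct-bracketʳ F₁ F₂ F₃) ⟨
    embed _ p₁,₂₃ (e₁ ++ᵥ (e₂ ++ᵥ e₃)) (joinedProduct F₂ F₃ >>= joinedProduct F₁)
      ≡⟨ embed->>= _ p₁,₂₃ _ (joinedProduct F₁) (joinedProduct F₂ F₃) ⟩
    joinedProduct F₂ F₃ >>= (embed _ p₁,₂₃ (e₁ ++ᵥ (e₂ ++ᵥ e₃)) ∘ joinedProduct F₁)
      ≈⟨ >>=-embed _ p₂₃ (e₂ ++ᵥ e₃) (b₁ ·₀_) (embed _ p₁,₂₃ (e₁ ++ᵥ (e₂ ++ᵥ e₃)) ∘ joinedProduct F₁)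
           (λ H d p → ·₀-embed F₁ p₁ e₁ H p (e₂ ++ᵥ e₃) p₁,₂₃ (cong (joinWord (decsF F₁)) (sym d)))
           (joinedProduct F₂ F₃) (joinedProduct-decs F₂ F₃) ⟨
    embed _ p₂₃ (e₂ ++ᵥ e₃) (joinedProduct F₂ F₃) >>= (b₁ ·₀_)
      ≈⟨ >>=-≋ (·₀-invariantʳ b₁) (·₀-embed F₂ p₂ e₂ F₃ p₃ e₃ p₂₃ refl) ⟨
    (b₂ ·₀ b₃) >>= (b₁ ·₀_) ∎
    where
    open ≋-Reasoning
    A₁ A₂ A₃ : Forest ((Fin m ⊎ Fin n) ⊎ Fin k)
    A₁ = mapF inj₁ (mapF inj₁ F₁)
    A₂ = mapF inj₁ (mapF inj₂ F₂)
    A₃ = mapF inj₂ F₃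
    p₁₂ : joinWord (decsF F₁) (decsF F₂) ↭ allFin (m +ℕ n)
    p₁₂ = joinWord-↭ p₁ p₂
    p₂₃ : joinWord (decsF F₂) (decsF F₃) ↭ allFin (n +ℕ k)
    p₂₃ = joinWord-↭ p₂ p₃
    p₁₂,₃ : joinWord (joinWord (decsF F₁) (decsF F₂)) (decsF F₃) ↭ allFin ((m +ℕ n) +ℕ k)
    p₁₂,₃ = joinWord-↭ p₁₂ p₃
    p₁,₂₃ : joinWord (decsF F₁) (joinWord (decsF F₂) (decsF F₃)) ↭ allFin (m +ℕ (n +ℕ k))
    p₁,₂₃ = joinWord-↭ p₁ p₂₃
    +-assoc : (m +ℕ n) +ℕ k ≡ m +ℕ (n +ℕ k)
    +-assoc = ℕₚ.+-assoc m n k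

  ·₀-rotaBaxter : ∀ b b′ → P₀ b ·₀ P₀ b′ ≋ P (P₀ b ·₀ b′) ++ P (b ·₀ P₀ b′) ++ scale λ′ (P (b ·₀ b′))
  ·₀-rotaBaxter (mkB m F p e) (mkB n G q e′) = begin
    mkB m (graft F) p e ·₀ mkB n (graft G) q e′
      ≈⟨ ·₀-embed (graft F) p e (graft G) q e′ pL refl ⟩
    embed′ (joinedProduct (graft F) (graft G))
      ≡⟨ cong embed′ (joinedProduct-rotaBaxter F G) ⟩
    embed′ (mapL graft (X₁ ++ X₂ ++ scale λ′ X₃))
      ≡⟨ embed-graft _ pL (e ++ᵥ e′) (X₁ ++ X₂ ++ scale λ′ X₃) ⟩
    P (embed′ (X₁ ++ X₂ ++ scale λ′ X₃))
      ≡⟨ cong P (embed-++₃ _ pL (e ++ᵥ e′) λ′ X₁ X₂ X₃) ⟩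
    P (embed′ X₁ ++ embed′ X₂ ++ scale λ′ (embed′ X₃))
      ≡⟨ mapL-++₃ P₀ λ′ (embed′ X₁) (embed′ X₂) (embed′ X₃) ⟩
    P (embed′ X₁) ++ P (embed′ X₂) ++ scale λ′ (P (embed′ X₃))
      ≈⟨ ≋-++ (P-≋ (·₀-embed (graft F) p e G q e′ pL refl))
              (≋-++ (P-≋ (·₀-embed F p e (graft G) q e′ pL refl)) (scale-≋ λ′ (P-≋ (·₀-embed F p e G q e′ pL refl)))) ⟨
    P (mkB m (graft F) p e ·₀ mkB n G q e′) ++ P (mkB m F p e ·₀ mkB n (graft G) q e′)
      ++ scale λ′ (P (mkB m F p e ·₀ mkB n G q e′)) ∎
    where
    open ≋-Reasoning
    pL : joinWord (decsF F) (decsF G) ↭ allFin (m +ℕ n)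
    pL = joinWord-↭ p q
    embed′ : Lin (Forest (Fin (m +ℕ n))) → Lin Basis
    embed′ = embed _ pL (e ++ᵥ e′)
    X₁ X₂ X₃ : Lin (Forest (Fin (m +ℕ n)))
    X₁ = joinedProduct (graft F) G
    X₂ = joinedProduct F (graft G)
    X₃ = joinedProduct F G

  ⊙-assoc : ∀ u v w → (u ⊙ v) ⊙ w ≋ u ⊙ (v ⊙ w)
  ⊙-assoc u v w = begin
    (u ⊙ v) ⊙ w
      ≈⟨ ∼⇒≋ (>>=-assoc _ _ u) ⟩
    u >>= (λ b → (v >>= (b ·₀_)) >>= λ x → w >>= (x ·₀_))
      ≈⟨ ∼⇒≋ (>>=-ext (λ b → >>=-assoc _ (b ·₀_) v) u) ⟩
    u >>= (λ b → v >>= λ b′ → (b ·₀ b′) >>= λ x → w >>= (x ·₀_))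
      ≈⟨ ∼⇒≋ (>>=-ext (λ b → >>=-ext (λ b′ → >>=-comm (λ x b″ → x ·₀ b″) (b ·₀ b′) w) v) u) ⟩
    u >>= (λ b → v >>= λ b′ → w >>= λ b″ → (b ·₀ b′) >>= (_·₀ b″))
      ≈⟨ >>=-ext≋ (λ b → >>=-ext≋ (λ b′ → >>=-ext≋ (λ b″ → ·₀-assoc b b′ b″) w) v) u ⟩
    u >>= (λ b → v >>= λ b′ → w >>= λ b″ → (b′ ·₀ b″) >>= (b ·₀_))
      ≈⟨ ∼⇒≋ (>>=-ext (λ b → >>=-ext (λ b′ → >>=-assoc (b ·₀_) (b′ ·₀_) w) v) u) ⟨
    u >>= (λ b → v >>= λ b′ → (w >>= (b′ ·₀_)) >>= (b ·₀_))
      ≈⟨ ∼⇒≋ (>>=-ext (λ b → >>=-assoc (b ·₀_) (λ b′ → w >>= (b′ ·₀_)) v) u) ⟨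
    u ⊙ (v ⊙ w) ∎
    where open ≋-Reasoning

  P-⊙ : ∀ u v → P (u ⊙ v) ≡ u >>= λ b → v >>= λ b′ → P (b ·₀ b′)
  P-⊙ u v = trans (mapL->>= P₀ _ u) (>>=-ext≡ (λ b → mapL->>= P₀ (b ·₀_) v) u)

  ⊙-rotaBaxter : ∀ u v → P u ⊙ P v ≋ P (P u ⊙ v ++ u ⊙ P v ++ scale λ′ (u ⊙ v))
  ⊙-rotaBaxter u v = begin
    P u ⊙ P v
      ≡⟨ trans (>>=-mapL _ P₀ u) (>>=-ext≡ (λ b → >>=-mapL (P₀ b ·₀_) P₀ v) u) ⟩
    u >>= (λ b → v >>= λ b′ → P₀ b ·₀ P₀ b′)
      ≈⟨ >>=-ext≋ (λ b → >>=-ext≋ (·₀-rotaBaxter b) v) u ⟩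
    u >>= (λ b → v >>= λ b′ → P (P₀ b ·₀ b′) ++ P (b ·₀ P₀ b′) ++ scale λ′ (P (b ·₀ b′)))
      ≈⟨ ∼⇒≋ (∼-trans (>>=-ext (λ b → >>=-distrib₃ λ′ _ _ _ v) u) (>>=-distrib₃ λ′ _ _ _ u)) ⟩
    (u >>= λ b → v >>= λ b′ → P (P₀ b ·₀ b′)) ++ (u >>= λ b → v >>= λ b′ → P (b ·₀ P₀ b′))
      ++ scale λ′ (u >>= λ b → v >>= λ b′ → P (b ·₀ b′))
      ≡⟨ cong₂ _++_ (trans (P-⊙ (P u) v) (>>=-mapL _ P₀ u))
                    (cong₂ _++_ (trans (P-⊙ u (P v)) (>>=-ext≡ (λ b → >>=-mapL _ P₀ v) u)) (cong (scale λ′) (P-⊙ u v))) ⟨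
    P (P u ⊙ v) ++ P (u ⊙ P v) ++ scale λ′ (P (u ⊙ v))
      ≡⟨ mapL-++₃ P₀ λ′ (P u ⊙ v) (u ⊙ P v) (u ⊙ v) ⟨
    P (P u ⊙ v ++ u ⊙ P v ++ scale λ′ (u ⊙ v)) ∎
    where open ≋-Reasoning

  ·-cong : ∀ {u u′ v v′} → u ≋ u′ → v ≋ v′ → u · v ≋ u′ · v′
  ·-cong {u} {u′} {v} {v′} u≋u′ v≋v′ = begin
    u · v     ≈⟨ ·≋⊙ u v ⟩
    u ⊙ v     ≈⟨ ⊙-congˡ v u≋u′ ⟩
    u′ ⊙ v    ≈⟨ ⊙-congʳ u′ v≋v′ ⟩
    u′ ⊙ v′   ≈⟨ ·≋⊙ u′ v′ ⟨
    u′ · v′   ∎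
    where open ≋-Reasoning

  ·-assoc : ∀ u v w → (u · v) · w ≋ u · (v · w)
  ·-assoc u v w = begin
    (u · v) · w   ≈⟨ ·≋⊙ (u · v) w ⟩
    (u · v) ⊙ w   ≈⟨ ⊙-congˡ w (·≋⊙ u v) ⟩
    (u ⊙ v) ⊙ w   ≈⟨ ⊙-assoc u v w ⟩
    u ⊙ (v ⊙ w)   ≈⟨ ⊙-congʳ u (·≋⊙ v w) ⟨
    u ⊙ (v · w)   ≈⟨ ·≋⊙ u (v · w) ⟨
    u · (v · w)   ∎
    where open ≋-Reasoning

  ·-identityˡ : ∀ u → unit · u ≋ u
  ·-identityˡ u = ≋-trans (·≋⊙ unit u) (⊙-identityˡ u)

  ·-identityʳ : ∀ u → u · unit ≋ u
  ·-identityʳ u = ≋-trans (·≋⊙ u unit) (⊙-identityʳ u)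

  ·-distribˡ : ∀ u v w → u · (v ++ w) ≋ u · v ++ u · w
  ·-distribˡ u v w =
    ∼⇒≋ (∼-trans (·∼⊙ u (v ++ w)) (∼-trans (⊙-distribˡ u v w) (∼-sym (∼-++ (·∼⊙ u v) (·∼⊙ u w)))))

  ·-distribʳ : ∀ u v w → (v ++ w) · u ≋ v · u ++ w · u
  ·-distribʳ u v w =
    ∼⇒≋ (∼-trans (·∼⊙ (v ++ w) u) (∼-trans (≡⇒∼ (⊙-distribʳ u v w)) (∼-sym (∼-++ (·∼⊙ v u) (·∼⊙ w u)))))

  ·-scaleˡ : ∀ a u v → scale a u · v ≋ scale a (u · v)
  ·-scaleˡ a u v =
    ∼⇒≋ (∼-trans (·∼⊙ (scale a u) v) (∼-trans (⊙-scaleˡ a u v) (scale-cong a (∼-sym (·∼⊙ u v)))))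

  ·-scaleʳ : ∀ a u v → u · scale a v ≋ scale a (u · v)
  ·-scaleʳ a u v =
    ∼⇒≋ (∼-trans (·∼⊙ u (scale a v)) (∼-trans (⊙-scaleʳ a u v) (scale-cong a (∼-sym (·∼⊙ u v)))))

  P-rotaBaxter : ∀ u v → P u · P v ≋ P (P u · v ++ u · P v ++ scale λ′ (u · v))
  P-rotaBaxter u v = begin
    P u · P v                                    ≈⟨ ·≋⊙ (P u) (P v) ⟩
    P u ⊙ P v                                    ≈⟨ ⊙-rotaBaxter u v ⟩
    P (P u ⊙ v ++ u ⊙ P v ++ scale λ′ (u ⊙ v))
      ≈⟨ P-≋ (≋-++ (·≋⊙ (P u) v) (≋-++ (·≋⊙ u (P v)) (scale-≋ λ′ (·≋⊙ u v)))) ⟨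
    P (P u · v ++ u · P v ++ scale λ′ (u · v))   ∎
    where open ≋-Reasoning

proposition4p10 : ∀ {c ℓ} (K : Field c ℓ) → CharZero K →
    (λ′ : Field.Carrier K) (E : Set) →
    Over.WithE.IsRotaBaxterAlgebra K E λ′
proposition4p10 K _ λ′ E = record
  { ·-cong       = ·-cong
  ; ·-assoc      = ·-assoc
  ; ·-identityˡ  = ·-identityˡ
  ; ·-identityʳ  = ·-identityʳ
  ; ·-distribˡ   = ·-distribˡ
  ; ·-distribʳ   = ·-distribʳ
  ; ·-scaleˡ     = ·-scaleˡ
  ; ·-scaleʳ     = ·-scaleʳ
  ; P-cong       = P-≋
  ; P-+          = P-++
  ; P-scale      = P-scale
  ; P-RotaBaxter = P-rotaBaxter
  }
  where open Coinvariants K λ′ E
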